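{- Assume $n=(q^m-1)/(q-1)$, $n'=(q^{m-1}-1)/(q-1)$, $n''=q^{m-1}$. Let $(B_0,\ldots,B_{n''-1})$ be a partition of the Hamming space $H(n'-1,q)$ into $(n'-1,q^{n'-1-(m-1)},3)_q$ codes. Let $(D_0,\ldots,D_{n''-1})$ be a partition of the $(n'',q^{n''-1},2)_q$ MDS code $M_0$ into $n''$ codes with parameters $(n'',q^{n''-m},3)_q$, where $$M_a:=\{x_1\ldots x_{n''}:\ x_1+\ldots+x_{n''}\equiv a \bmod q\},\quad a\in\{0,\ldots,q-1\}.$$ \begin{itemize} \item[(i)] The code $S:=\bigcup_{i=0}^{q^{m-1}-1} D_iB_i$ is an $(n-1,q^{n-1-m},3)_q$ code. \item[(ii)] $S$ can be lengthened to a $1$-perfect $(n,q^{n-m},3)_q$ code if and only if every $B_i$ can be lengthened to a $1$-perfect $(n',q^{n'-(m-1)},3)_q$ code $C_i$ such that $C_0,\ldots,C_{q^{m-1}-1}$ form a partition of the Hamming space $H(n',q)$. \item[(iii)] There is a partition of $H(n-1,q)$ into $q^m$ codes $(n-1,q^{n-1-m},3)_q$, one of which is $S$. \end{itemize}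
   Context: $H(n,q)$ is the Hamming graph on the $n$-words over $\{0,1,\ldots,q-1\}$, adjacent words differing in exactly one position. An $(n,M,d)_q$-code is a set of $M$ vertices with minimum Hamming distance $d$; MDS codes attain $M=q^{n-d+1}$. For codes $C$, $D$, $CD:=\{\mathbf{x}\mathbf{y}:\ \mathbf{x}\in C,\ \mathbf{y}\in D\}$ (concatenation). A code $C^-$ obtained from $C$ by taking the codewords with a fixed symbol in position $j$ and deleting position $j$ is a shortened $C$, and $C$ is then a lengthened $C^-$. A $1$-perfect code is a set of vertices such that every vertex is at distance $0$ or $1$ from exactly one element of it. -}

module Defs where

open import Data.Unit using (⊤)
open import Data.Nat using (ℕ; zero; suc; _+_; _*_; _∸_; _^_; _≤_; NonZero)
open import Data.Nat.DivMod using (_%_)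
open import Data.Fin using (Fin; toℕ)
open import Data.Vec using (Vec; []; _∷_; _++_; insertAt)
open import Data.List using (List; length)
open import Data.List.Membership.Propositional using (_∈_)
open import Data.List.Relation.Unary.Unique.Propositional using (Unique)
open import Data.Product using (Σ; ∃; ∃-syntax; _×_; _,_)
open import Relation.Binary.PropositionalEquality using (_≡_; _≢_)
open import Relation.Nullary using (Dec; yes; no)
open import Data.Fin using (_≟_)

Word : ℕ → ℕ → Set
Word q n = Vec (Fin q) n

Code : ℕ → ℕ → Set₁
Code q n = Word q n → Set

dist : ∀ {q n} → Word q n → Word q n → ℕ
dist [] [] = 0
dist (x ∷ xs) (y ∷ ys) with x ≟ y
... | yes _ = dist xs ys
... | no  _ = suc (dist xs ys)

HasSize : ∀ {q n} → Code q n → ℕ → Set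
HasSize {q} {n} C M =
  Σ (List (Word q n)) λ l →
    Unique l × length l ≡ M × (∀ x → (C x → x ∈ l) × (x ∈ l → C x))

IsCode : ∀ q n → Code q n → ℕ → ℕ → Set
IsCode q n C M d =
  HasSize C M × (∀ x y → C x → C y → x ≢ y → d ≤ dist x y)

IsPerfect1 : ∀ {q n} → Code q n → Set
IsPerfect1 {q} {n} C =
  ∀ (x : Word q n) → Σ (Word q n) λ c →
    (C c × dist x c ≤ 1) × (∀ c′ → C c′ → dist x c′ ≤ 1 → c′ ≡ c)

-- S is the shortened C at position j with symbol a (equivalently C is a
-- lengthened S): S = { x with x_j = a, position j deleted }.
IsShortening : ∀ {q n} → Code q (suc n) → Fin (suc n) → Fin q → Code q n → Set
IsShortening {q} {n} C j a S =
  ∀ (x : Word q n) → (S x → C (insertAt x j a)) × (C (insertAt x j a) → S x)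

IsPartitionOf : ∀ {q n N} → Code q n → (Fin N → Code q n) → Set
IsPartitionOf {q} {n} {N} A P =
  (∀ i x → P i x → A x)
  × (∀ x → A x → ∃[ i ] P i x)
  × (∀ i k x → P i x → P k x → i ≡ k)

Whole : ∀ {q n} → Code q n
Whole _ = ⊤

symSum : ∀ {q n} → Word q n → ℕ
symSum [] = 0
symSum (x ∷ xs) = toℕ x + symSum xs

Mcode : ∀ q n .{{_ : NonZero q}} → ℕ → Code q n
Mcode q n a x = symSum x % q ≡ a

unionConcat : ∀ {q k l N} → (Fin N → Code q k) → (Fin N → Code q l) → Code q (k + l)
unionConcat {q} {k} {l} D B z =
  ∃[ i ] Σ (Word q k) λ u → Σ (Word q l) λ v → D i u × B i v × z ≡ u ++ v

-- Split the words of H(n-1,q) as u v with u of length N = q^(m-1).  Distinct words of M₀ are at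
-- distance at least 2, so two words of S = ⋃ Dᵢ Bᵢ from different classes differ in both halves and S
-- has minimum distance 3; its size is a product count.  A word u ∉ M₀ has exactly one neighbour in
-- each class Dₖ, because its N neighbours in M₀ are pairwise at distance 2.  Hence ⋃ Dᵢ Cᵢ is 1-perfect
-- whenever the Cᵢ are 1-perfect and partition H(n′,q).  Conversely, once the extra coordinate of a
-- perfect lengthening C of S is moved right after the first N positions, every codeword of C has its
-- prefix in M₀, and the slices of C above the neighbours of a fixed u* ∉ M₀ are perfect lengthenings
-- of the Bₖ that partition H(n′,q).  The sizes of perfect codes come from the sphere-packing identity
-- |C| (1 + n (q-1)) = qⁿ.  For (iii), shifting one symbol moves the Dᵢ into M_a, and pairing Dᵢ with
-- B_{i+k} (indices mod N) gives q N = q^m disjoint codes covering H(n-1,q).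

{-# OPTIONS --safe #-}
module Submission where

open import Defs
open import Data.Bool.Base using (true; false; if_then_else_)
open import Data.Empty using (⊥; ⊥-elim)
open import Data.Unit using (tt)
open import Data.Fin as Fin using (Fin; toℕ; punchIn; punchOut)
import Data.Fin.Properties as Finₚ
open import Data.List as List using (List; length; filter; cartesianProductWith; allFin)
open import Data.List.Properties using (length-map)
open import Data.List.Membership.Propositional using (_∈_)
open import Data.List.Membership.Propositional.Properties
  using (∈-cartesianProductWith⁺; ∈-allFin; ∈-filter⁺; ∈-filter⁻; ∈-map⁺; ∈-map⁻)
open import Data.List.Relation.Unary.All using ([])
open import Data.List.Relation.Unary.All.Properties using (All¬⇒¬Any)
open import Data.List.Relation.Unary.AllPairs using ([]; _∷_)
open import Data.List.Relation.Unary.Any using (here; there; any?)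
open import Data.List.Relation.Unary.Unique.Propositional using (Unique)
import Data.List.Relation.Unary.Unique.Propositional.Properties as Uniqueₚ
open import Data.Nat using (ℕ; zero; suc; pred; _+_; _*_; _∸_; _^_; _≤_; _<_; _≤?_; NonZero; >-nonZero⁻¹; z≤n; s≤s)
  renaming (_≟_ to _≟ℕ_)
open import Data.Nat.DivMod using (_%_; _mod_; %-distribˡ-+; m%n%n≡m%n; %-remove-+ʳ; m<n⇒m%n≡m)
open import Data.Nat.Divisibility using (_∣_; divides; n∣m⇒m%n≡0)
open import Data.Nat.Properties
open import Data.Nat.Tactic.RingSolver using (solve-∀)
open import Algebra.Properties.CommutativeSemigroup +-commutativeSemigroup
  using () renaming (interchange to +-interchange; x∙yz≈y∙xz to x+[y+z]≡y+[x+z])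
open import Algebra.Properties.Semiring.Sum +-*-semiring
  using (sum-syntax; sum-cong-≗; sum-replicate-zero; ∑-distrib-+; ∑-comm; *-distribˡ-sum; *-distribʳ-sum)
open import Data.Product using (Σ; ∃-syntax; _×_; _,_; proj₁; proj₂; uncurry)
open import Data.Vec using ([]; _∷_; _++_; insertAt; removeAt; lookup; splitAt; replicate)
open import Data.Vec.Properties
  using ( ≡-dec; ∷-injective; ++-injectiveˡ; ++-injectiveʳ
        ; insertAt-removeAt; removeAt-insertAt; insertAt-lookup; insertAt-punchIn; removeAt-punchOut)
open import Function using (_∘_)
open import Function.Definitions using (Injective)
open import Function.Bundles using (_⇔_; mk⇔; Equivalence; _↔_; mk↔ₛ′; Inverse)
open import Function.Construct.Composition using (_↔-∘_)
open import Relation.Binary.PropositionalEquality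
open import Relation.Nullary using (Dec; does; yes; no; ¬_; ¬?)
open import Relation.Nullary.Decidable as Dec using (_×-dec_; does-⇔; dec-false)
open import Relation.Unary using (Decidable)

variable
  q n : ℕ

-- Indicators and finite sums

𝟙 : ∀ {a} {P : Set a} → Dec P → ℕ
𝟙 P? = if does P? then 1 else 0

module _ {a b} {P : Set a} {Q : Set b} where

  𝟙-cong : P ⇔ Q → (P? : Dec P) (Q? : Dec Q) → 𝟙 P? ≡ 𝟙 Q?
  𝟙-cong P⇔Q P? Q? = cong (λ b → if b then 1 else 0) (does-⇔ P⇔Q P? Q?)

  𝟙-×-dec : (P? : Dec P) (Q? : Dec Q) → 𝟙 (P? ×-dec Q?) ≡ 𝟙 P? * 𝟙 Q?
  𝟙-×-dec P? Q? with does P? | does Q?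
  ... | true  | true  = refl
  ... | true  | false = refl
  ... | false | _     = refl

module _ {a} {P : Set a} where

  𝟙-no : (P? : Dec P) → ¬ P → 𝟙 P? ≡ 0
  𝟙-no P? ¬p rewrite dec-false P? ¬p = refl

  𝟙+𝟙¬ : (P? : Dec P) → 𝟙 P? + 𝟙 (¬? P?) ≡ 1
  𝟙+𝟙¬ P? with does P?
  ... | true  = refl
  ... | false = refl

∑-const : ∀ n c → ∑[ i < n ] c ≡ n * c
∑-const zero    c = refl
∑-const (suc n) c = cong (c +_) (∑-const n c)

∑-point : ∀ {n} (i : Fin n) → ∑[ j < n ] 𝟙 (j Fin.≟ i) ≡ 1
∑-point {suc n} Fin.zero    = cong suc (sum-replicate-zero n)
∑-point {suc n} (Fin.suc i) = ∑-point i

∑-atMostOne : ∀ {n p} {Q : Fin n → Set p} (Q? : Decidable Q) → (∀ i j → Q i → Q j → i ≡ j) →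
              ∑[ i < n ] 𝟙 (Q? i) ≡ 𝟙 (Finₚ.any? Q?)
∑-atMostOne {zero}  Q? unique = refl
∑-atMostOne {suc n} Q? unique with Q? Fin.zero
... | yes Q₀ = cong suc (trans (sum-cong-≗ (λ i → 𝟙-no (Q? (Fin.suc i)) (λ Qᵢ → Finₚ.0≢1+n (unique _ _ Q₀ Qᵢ))))
                               (sum-replicate-zero n))
... | no ¬Q₀ = ∑-atMostOne (Q? ∘ Fin.suc) (λ i j Qᵢ Qⱼ → Finₚ.suc-injective (unique _ _ Qᵢ Qⱼ))

injective⇒surjective : ∀ {n} (f : Fin n → Fin n) → Injective _≡_ _≡_ f → ∀ k → ∃[ i ] f i ≡ k
injective⇒surjective {suc n} f f-inj k with Finₚ.any? (λ i → f i Fin.≟ k)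
... | yes hit  = hit
... | no  miss = ⊥-elim (Finₚ.<⇒notInjective (n<1+n n) (f-inj ∘ Finₚ.punchOut-injective (k≢f _) (k≢f _)))
  where
  k≢f : ∀ i → k ≢ f i
  k≢f i k≡fi = miss (i , sym k≡fi)

cast-↔ : ∀ {m n} → m ≡ n → Fin m ↔ Fin n
cast-↔ eq = mk↔ₛ′ (Fin.cast eq) (Fin.cast (sym eq)) (Finₚ.cast-involutive eq (sym eq)) (Finₚ.cast-involutive (sym eq) eq)

_≟ʷ_ : (x y : Word q n) → Dec (x ≡ y)
_≟ʷ_ = ≡-dec Fin._≟_

∑ʷ : (Word q n → ℕ) → ℕ
∑ʷ {n = zero}  f = f []
∑ʷ {q} {suc n} f = ∑[ x < q ] ∑ʷ (λ w → f (x ∷ w))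

∑ʷ-cong : {f g : Word q n → ℕ} → (∀ w → f w ≡ g w) → ∑ʷ f ≡ ∑ʷ g
∑ʷ-cong {n = zero}  f≗g = f≗g []
∑ʷ-cong {n = suc n} f≗g = sum-cong-≗ (λ x → ∑ʷ-cong (λ w → f≗g (x ∷ w)))

∑ʷ-distrib-+ : (f g : Word q n → ℕ) → ∑ʷ (λ w → f w + g w) ≡ ∑ʷ f + ∑ʷ g
∑ʷ-distrib-+ {n = zero}  f g = refl
∑ʷ-distrib-+ {n = suc n} f g =
  trans (sum-cong-≗ (λ x → ∑ʷ-distrib-+ (f ∘ (x ∷_)) (g ∘ (x ∷_))))
        (∑-distrib-+ (λ x → ∑ʷ (f ∘ (x ∷_))) (λ x → ∑ʷ (g ∘ (x ∷_))))

*-distribˡ-∑ʷ : ∀ c (f : Word q n → ℕ) → c * ∑ʷ f ≡ ∑ʷ (λ w → c * f w)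
*-distribˡ-∑ʷ {n = zero}  c f = refl
*-distribˡ-∑ʷ {n = suc n} c f =
  trans (*-distribˡ-sum c (λ x → ∑ʷ (f ∘ (x ∷_)))) (sum-cong-≗ (λ x → *-distribˡ-∑ʷ c (f ∘ (x ∷_))))

*-distribʳ-∑ʷ : ∀ c (f : Word q n → ℕ) → ∑ʷ f * c ≡ ∑ʷ (λ w → f w * c)
*-distribʳ-∑ʷ {n = zero}  c f = refl
*-distribʳ-∑ʷ {n = suc n} c f =
  trans (*-distribʳ-sum c (λ x → ∑ʷ (f ∘ (x ∷_)))) (sum-cong-≗ (λ x → *-distribʳ-∑ʷ c (f ∘ (x ∷_))))

∑ʷ-const : ∀ {q n} c → ∑ʷ {q} {n} (λ _ → c) ≡ q ^ n * c
∑ʷ-const {n = zero}      c = sym (*-identityˡ c)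
∑ʷ-const {q} {n = suc n} c = begin
  ∑[ x < q ] ∑ʷ {q} {n} (λ _ → c) ≡⟨ sum-cong-≗ {q} (λ _ → ∑ʷ-const {q} {n} c) ⟩
  ∑[ x < q ] (q ^ n * c)          ≡⟨ ∑-const q (q ^ n * c) ⟩
  q * (q ^ n * c)                 ≡⟨ *-assoc q (q ^ n) c ⟨
  q ^ suc n * c                   ∎
  where open ≡-Reasoning

∑ʷ-∑-comm : ∀ {N} (f : Word q n → Fin N → ℕ) →
            ∑ʷ (λ w → ∑[ i < N ] f w i) ≡ ∑[ i < N ] ∑ʷ (λ w → f w i)
∑ʷ-∑-comm {n = zero}  f = refl
∑ʷ-∑-comm {n = suc n} f =
  trans (sum-cong-≗ (λ x → ∑ʷ-∑-comm (f ∘ (x ∷_)))) (∑-comm (λ x i → ∑ʷ (λ w → f (x ∷ w) i)))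

∑ʷ-comm : ∀ {k} (f : Word q n → Word q k → ℕ) →
          ∑ʷ (λ w → ∑ʷ (f w)) ≡ ∑ʷ (λ c → ∑ʷ (λ w → f w c))
∑ʷ-comm {n = zero}  f = refl
∑ʷ-comm {q} {suc n} {k} f =
  trans (sum-cong-≗ (λ x → ∑ʷ-comm (f ∘ (x ∷_)))) (sym (∑ʷ-∑-comm {q} {k} (λ c x → ∑ʷ (λ w → f (x ∷ w) c))))

∑ʷ-++ : ∀ {q k l} (f : Word q (k + l) → ℕ) → ∑ʷ f ≡ ∑ʷ {q} {k} (λ u → ∑ʷ {q} {l} (λ v → f (u ++ v)))
∑ʷ-++ {k = zero}  f = refl
∑ʷ-++ {q} {suc k} {l} f = sum-cong-≗ (λ x → ∑ʷ-++ {q} {k} {l} (f ∘ (x ∷_)))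

∑ʷ-product : ∀ {q k l} (f : Word q k → ℕ) (g : Word q l → ℕ) →
             ∑ʷ (λ u → ∑ʷ (λ v → f u * g v)) ≡ ∑ʷ f * ∑ʷ g
∑ʷ-product f g = trans (∑ʷ-cong (λ u → sym (*-distribˡ-∑ʷ (f u) g))) (sym (*-distribʳ-∑ʷ (∑ʷ g) f))

∑ʷ-point : (c : Word q n) → ∑ʷ (λ w → 𝟙 (w ≟ʷ c)) ≡ 1
∑ʷ-point []      = refl
∑ʷ-point {q} {suc n} (x ∷ c) = trans (sum-cong-≗ row) (∑-point x)
  where
  row : ∀ y → ∑ʷ (λ w → 𝟙 ((y Fin.≟ x) ×-dec (w ≟ʷ c))) ≡ 𝟙 (y Fin.≟ x)
  row y = begin
    ∑ʷ (λ w → 𝟙 ((y Fin.≟ x) ×-dec (w ≟ʷ c)))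
      ≡⟨ ∑ʷ-cong (λ w → 𝟙-×-dec (y Fin.≟ x) (w ≟ʷ c)) ⟩
    ∑ʷ (λ w → 𝟙 (y Fin.≟ x) * 𝟙 (w ≟ʷ c))
      ≡⟨ *-distribˡ-∑ʷ (𝟙 (y Fin.≟ x)) (λ w → 𝟙 (w ≟ʷ c)) ⟨
    𝟙 (y Fin.≟ x) * ∑ʷ (λ w → 𝟙 (w ≟ʷ c))
      ≡⟨ cong (𝟙 (y Fin.≟ x) *_) (∑ʷ-point c) ⟩
    𝟙 (y Fin.≟ x) * 1
      ≡⟨ *-identityʳ _ ⟩
    𝟙 (y Fin.≟ x)
      ∎
    where open ≡-Reasoning

∑ʷ-single : ∀ {p} {Q : Word q n → Set p} (Q? : Decidable Q) (c : Word q n) →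
            Q c → (∀ w → Q w → w ≡ c) → ∑ʷ (λ w → 𝟙 (Q? w)) ≡ 1
∑ʷ-single Q? c Qc unique =
  trans (∑ʷ-cong (λ w → 𝟙-cong (mk⇔ (unique w) (λ { refl → Qc })) (Q? w) (w ≟ʷ c))) (∑ʷ-point c)

count : ∀ {p} {P : Word q n → Set p} → Decidable P → ℕ
count P? = ∑ʷ (λ w → 𝟙 (P? w))

allWords : List (Word q n)
allWords {n = zero}  = List.[ [] ]
allWords {q} {suc n} = cartesianProductWith _∷_ (allFin q) allWords

∈-allWords : (w : Word q n) → w ∈ allWords
∈-allWords []      = here refl
∈-allWords (x ∷ w) = ∈-cartesianProductWith⁺ _∷_ (∈-allFin x) (∈-allWords w)

allWords-unique : ∀ {q n} → Unique (allWords {q} {n})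
allWords-unique {n = zero}  = [] ∷ []
allWords-unique {q} {suc n} = Uniqueₚ.cartesianProductWith⁺ _∷_ ∷-injective (Uniqueₚ.allFin⁺ q) allWords-unique

_∈ʷ?_ : (w : Word q n) (l : List (Word q n)) → Dec (w ∈ l)
w ∈ʷ? l = any? (w ≟ʷ_) l

Unique⇒length≡count : (l : List (Word q n)) → Unique l → length l ≡ count (_∈ʷ? l)
Unique⇒length≡count {q} {n} List.[] _ = sym (trans (∑ʷ-const {q} {n} 0) (*-zeroʳ (q ^ n)))
Unique⇒length≡count (x List.∷ l) (x∉l ∷ unique) = begin
  suc (length l)                                 ≡⟨ cong suc (Unique⇒length≡count l unique) ⟩
  1 + count (_∈ʷ? l)                             ≡⟨ cong (_+ count (_∈ʷ? l)) (∑ʷ-point x) ⟨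
  ∑ʷ (λ w → 𝟙 (w ≟ʷ x)) + count (_∈ʷ? l)         ≡⟨ ∑ʷ-distrib-+ (𝟙 ∘ (_≟ʷ x)) (𝟙 ∘ (_∈ʷ? l)) ⟨
  ∑ʷ (λ w → 𝟙 (w ≟ʷ x) + 𝟙 (w ∈ʷ? l))            ≡⟨ ∑ʷ-cong split ⟩
  count (_∈ʷ? (x List.∷ l))                      ∎
  where
  open ≡-Reasoning
  split : ∀ w → 𝟙 (w ≟ʷ x) + 𝟙 (w ∈ʷ? l) ≡ 𝟙 (w ∈ʷ? (x List.∷ l))
  split w with w ≟ʷ x
  ... | yes refl = cong suc (𝟙-no (w ∈ʷ? l) (All¬⇒¬Any x∉l))
  ... | no  _    = refl

module _ {P : Code q n} where

  HasSize⇒≡count : ∀ {M} → HasSize P M → (P? : Decidable P) → M ≡ count P?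
  HasSize⇒≡count (l , unique , refl , mem) P? =
    trans (Unique⇒length≡count l unique)
          (∑ʷ-cong (λ w → 𝟙-cong (mk⇔ (proj₂ (mem w)) (proj₁ (mem w))) (w ∈ʷ? l) (P? w)))

  HasSize-count : (P? : Decidable P) → HasSize P (count P?)
  HasSize-count P? = l , unique , HasSize⇒≡count (l , unique , refl , mem) P? , mem
    where
    l = filter P? allWords
    unique : Unique l
    unique = Uniqueₚ.filter⁺ P? allWords-unique
    mem : ∀ w → (P w → w ∈ l) × (w ∈ l → P w)
    mem w = ∈-filter⁺ P? (∈-allWords w) , λ w∈l → proj₂ (∈-filter⁻ P? {xs = allWords} w∈l)

  HasSize⇒Decidable : ∀ {M} → HasSize P M → Decidable P
  HasSize⇒Decidable (l , _ , _ , mem) w = Dec.map (mk⇔ (proj₂ (mem w)) (proj₁ (mem w))) (w ∈ʷ? l)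

mismatch : Fin q → Fin q → ℕ
mismatch x y = 𝟙 (¬? (x Fin.≟ y))

mismatch-refl : (x : Fin q) → mismatch x x ≡ 0
mismatch-refl x = 𝟙-no (¬? (x Fin.≟ x)) (λ x≢x → x≢x refl)

mismatch-sym : (x y : Fin q) → mismatch x y ≡ mismatch y x
mismatch-sym x y = 𝟙-cong (mk⇔ (λ x≢y → x≢y ∘ sym) (λ y≢x → y≢x ∘ sym)) (¬? (x Fin.≟ y)) (¬? (y Fin.≟ x))

mismatch≤1 : (x y : Fin q) → mismatch x y ≤ 1
mismatch≤1 x y with x Fin.≟ y
... | yes _ = z≤n
... | no  _ = s≤s z≤n

mismatch≡0⇒≡ : (x y : Fin q) → mismatch x y ≡ 0 → x ≡ y
mismatch≡0⇒≡ x y eq with x Fin.≟ y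
... | yes x≡y = x≡y

mismatch-triangle : (x y z : Fin q) → mismatch x z ≤ mismatch x y + mismatch y z
mismatch-triangle x y z with x Fin.≟ z | x Fin.≟ y | y Fin.≟ z
... | yes _ | _        | _     = z≤n
... | no  _ | no _     | _     = s≤s z≤n
... | no  _ | yes _    | no _  = s≤s z≤n
... | no x≢z | yes refl | yes refl = ⊥-elim (x≢z refl)

dist-∷ : (x y : Fin q) (xs ys : Word q n) → dist (x ∷ xs) (y ∷ ys) ≡ mismatch x y + dist xs ys
dist-∷ x y xs ys with x Fin.≟ y
... | yes _ = refl
... | no  _ = refl

dist-refl : (x : Word q n) → dist x x ≡ 0
dist-refl []       = refl
dist-refl (x ∷ xs) = trans (dist-∷ x x xs xs) (cong₂ _+_ (mismatch-refl x) (dist-refl xs))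

dist≡0⇒≡ : (x y : Word q n) → dist x y ≡ 0 → x ≡ y
dist≡0⇒≡ []       []       _  = refl
dist≡0⇒≡ (x ∷ xs) (y ∷ ys) eq =
  cong₂ _∷_ (mismatch≡0⇒≡ x y (m+n≡0⇒m≡0 _ eq′)) (dist≡0⇒≡ xs ys (m+n≡0⇒n≡0 (mismatch x y) eq′))
  where eq′ = trans (sym (dist-∷ x y xs ys)) eq

≢⇒1≤dist : (x y : Word q n) → x ≢ y → 1 ≤ dist x y
≢⇒1≤dist x y x≢y with dist x y in eq
... | zero  = ⊥-elim (x≢y (dist≡0⇒≡ x y eq))
... | suc _ = s≤s z≤n

dist-sym : (x y : Word q n) → dist x y ≡ dist y x
dist-sym []       []       = refl
dist-sym (x ∷ xs) (y ∷ ys) = begin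
  dist (x ∷ xs) (y ∷ ys)    ≡⟨ dist-∷ x y xs ys ⟩
  mismatch x y + dist xs ys ≡⟨ cong₂ _+_ (mismatch-sym x y) (dist-sym xs ys) ⟩
  mismatch y x + dist ys xs ≡⟨ dist-∷ y x ys xs ⟨
  dist (y ∷ ys) (x ∷ xs)    ∎
  where open ≡-Reasoning

dist-triangle : (x y z : Word q n) → dist x z ≤ dist x y + dist y z
dist-triangle []       []       []       = z≤n
dist-triangle (x ∷ xs) (y ∷ ys) (z ∷ zs) = begin
  dist (x ∷ xs) (z ∷ zs)
    ≡⟨ dist-∷ x z xs zs ⟩
  mismatch x z + dist xs zs
    ≤⟨ +-mono-≤ (mismatch-triangle x y z) (dist-triangle xs ys zs) ⟩
  (mismatch x y + mismatch y z) + (dist xs ys + dist ys zs)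
    ≡⟨ +-interchange (mismatch x y) (mismatch y z) (dist xs ys) (dist ys zs) ⟩
  (mismatch x y + dist xs ys) + (mismatch y z + dist ys zs)
    ≡⟨ cong₂ _+_ (dist-∷ x y xs ys) (dist-∷ y z ys zs) ⟨
  dist (x ∷ xs) (y ∷ ys) + dist (y ∷ ys) (z ∷ zs)
    ∎
  where open ≤-Reasoning

dist-sameHead : (a : Fin q) (x y : Word q n) → dist (a ∷ x) (a ∷ y) ≡ dist x y
dist-sameHead a x y = trans (dist-∷ a a x y) (cong (_+ dist x y) (mismatch-refl a))

dist-sameTail≤1 : (a b : Fin q) (x : Word q n) → dist (a ∷ x) (b ∷ x) ≤ 1
dist-sameTail≤1 a b x = subst (_≤ 1) (sym (trans (dist-∷ a b x x) (cong (mismatch a b +_) (dist-refl x))))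
                              (subst (_≤ 1) (sym (+-identityʳ _)) (mismatch≤1 a b))

dist-++ : ∀ {k l} (u u′ : Word q k) (v v′ : Word q l) → dist (u ++ v) (u′ ++ v′) ≡ dist u u′ + dist v v′
dist-++ []      []       v v′ = refl
dist-++ (x ∷ u) (y ∷ u′) v v′ = begin
  dist (x ∷ u ++ v) (y ∷ u′ ++ v′)        ≡⟨ dist-∷ x y (u ++ v) (u′ ++ v′) ⟩
  mismatch x y + dist (u ++ v) (u′ ++ v′) ≡⟨ cong (mismatch x y +_) (dist-++ u u′ v v′) ⟩
  mismatch x y + (dist u u′ + dist v v′)  ≡⟨ +-assoc (mismatch x y) _ _ ⟨
  mismatch x y + dist u u′ + dist v v′    ≡⟨ cong (_+ dist v v′) (dist-∷ x y u u′) ⟨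
  dist (x ∷ u) (y ∷ u′) + dist v v′       ∎
  where open ≡-Reasoning

dist-insertAt : (x y : Word q n) (j : Fin (suc n)) (a b : Fin q) →
                dist (insertAt x j a) (insertAt y j b) ≡ dist (a ∷ x) (b ∷ y)
dist-insertAt x        y        Fin.zero    a b = refl
dist-insertAt (x ∷ xs) (y ∷ ys) (Fin.suc j) a b = begin
  dist (x ∷ insertAt xs j a) (y ∷ insertAt ys j b)        ≡⟨ dist-∷ x y _ _ ⟩
  mismatch x y + dist (insertAt xs j a) (insertAt ys j b) ≡⟨ cong (mismatch x y +_) (dist-insertAt xs ys j a b) ⟩
  mismatch x y + dist (a ∷ xs) (b ∷ ys)                   ≡⟨ cong (mismatch x y +_) (dist-∷ a b xs ys) ⟩
  mismatch x y + (mismatch a b + dist xs ys)              ≡⟨ x+[y+z]≡y+[x+z] (mismatch x y) (mismatch a b) (dist xs ys) ⟩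
  mismatch a b + (mismatch x y + dist xs ys)              ≡⟨ cong (mismatch a b +_) (dist-∷ x y xs ys) ⟨
  mismatch a b + dist (x ∷ xs) (y ∷ ys)                   ≡⟨ dist-∷ a b (x ∷ xs) (y ∷ ys) ⟨
  dist (a ∷ x ∷ xs) (b ∷ y ∷ ys)                          ∎
  where open ≡-Reasoning

midpoint : (x y : Word q n) → dist x y ≤ 2 → ∃[ w ] dist x w ≤ 1 × dist w y ≤ 1
midpoint []      []      _   = [] , z≤n , z≤n
midpoint (a ∷ x) (b ∷ y) d≤2 with a Fin.≟ b
... | yes refl = let w , xw , wy = midpoint x y d≤2 in
  a ∷ w , subst (_≤ 1) (sym (dist-sameHead a x w)) xw , subst (_≤ 1) (sym (dist-sameHead a w y)) wy
... | no  _    = b ∷ x , dist-sameTail≤1 a b x , subst (_≤ 1) (sym (dist-sameHead b x y)) (≤-pred d≤2)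

-- Minimum distance, perfect codes and the sphere-packing identity

+≤1⇒≤1 : ∀ m {n} → m + n ≤ 1 → m ≤ 1 × n ≤ 1
+≤1⇒≤1 m m+n≤1 = m+n≤o⇒m≤o m m+n≤1 , m+n≤o⇒n≤o m m+n≤1

1≤m⇒m+n≤1⇒n≡0 : ∀ {m n} → 1 ≤ m → m + n ≤ 1 → n ≡ 0
1≤m⇒m+n≤1⇒n≡0 {suc m} _ (s≤s m+n≤0) = n≤0⇒n≡0 (m+n≤o⇒n≤o m m+n≤0)

MinDist : Code q n → ℕ → Set
MinDist C d = ∀ x y → C x → C y → x ≢ y → d ≤ dist x y

module _ {C : Code q n} where

  MinDist3⇒uniqueNeighbour : MinDist C 3 → ∀ u {c c′} → C c → C c′ → dist u c ≤ 1 → dist u c′ ≤ 1 → c ≡ c′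
  MinDist3⇒uniqueNeighbour minDist u {c} {c′} Cc Cc′ uc uc′ with c ≟ʷ c′
  ... | yes c≡c′ = c≡c′
  ... | no  c≢c′ = ⊥-elim (<⇒≱ (s≤s (s≤s (s≤s z≤n))) (begin
    3                     ≤⟨ minDist c c′ Cc Cc′ c≢c′ ⟩
    dist c c′             ≤⟨ dist-triangle c u c′ ⟩
    dist c u + dist u c′  ≤⟨ +-mono-≤ (subst (_≤ 1) (dist-sym u c) uc) uc′ ⟩
    2                     ∎))
    where open ≤-Reasoning

  IsPerfect1⇒MinDist3 : IsPerfect1 C → MinDist C 3
  IsPerfect1⇒MinDist3 perfect x y Cx Cy x≢y with 3 ≤? dist x y
  ... | yes 3≤d = 3≤d
  ... | no  3≰d =
    let w , xw , wy = midpoint x y (≤-pred (≰⇒> 3≰d))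
        _ , _ , unique = perfect w
    in ⊥-elim (x≢y (trans (unique x Cx (subst (_≤ 1) (dist-sym x w) xw)) (sym (unique y Cy wy))))

  IsPerfect1⇒uniqueNeighbour : IsPerfect1 C →
                               ∀ y {c c′} → C c → C c′ → dist y c ≤ 1 → dist y c′ ≤ 1 → c ≡ c′
  IsPerfect1⇒uniqueNeighbour perfect y Cc Cc′ yc yc′ =
    let _ , _ , unique = perfect y in trans (unique _ Cc yc) (sym (unique _ Cc′ yc′))

  IsPerfect1⇒Decidable : IsPerfect1 C → Decidable C
  IsPerfect1⇒Decidable perfect x =
    let c , (Cc , _) , unique = perfect x
        x≡c⇔Cx = mk⇔ (λ x≡c → subst C (sym x≡c) Cc) (λ Cx → unique x Cx (≤-trans (≤-reflexive (dist-refl x)) z≤n))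
    in Dec.map x≡c⇔Cx (x ≟ʷ c)

module _ {q₀ : ℕ} where

  ∑-mismatch : (x : Fin (suc q₀)) → ∑[ y < suc q₀ ] mismatch y x ≡ q₀
  ∑-mismatch x = +-cancelˡ-≡ 1 _ _ (begin
    1 + ∑[ y < suc q₀ ] mismatch y x
      ≡⟨ cong (_+ ∑[ y < suc q₀ ] mismatch y x) (∑-point x) ⟨
    ∑[ y < suc q₀ ] 𝟙 (y Fin.≟ x) + ∑[ y < suc q₀ ] mismatch y x
      ≡⟨ ∑-distrib-+ (λ y → 𝟙 (y Fin.≟ x)) (λ y → mismatch y x) ⟨
    ∑[ y < suc q₀ ] (𝟙 (y Fin.≟ x) + mismatch y x)
      ≡⟨ sum-cong-≗ (λ y → 𝟙+𝟙¬ (y Fin.≟ x)) ⟩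
    ∑[ y < suc q₀ ] 1
      ≡⟨ trans (∑-const (suc q₀) 1) (*-identityʳ (suc q₀)) ⟩
    suc q₀
      ∎)
    where open ≡-Reasoning

  ball-size : ∀ {n} (c : Word (suc q₀) n) → count (λ w → dist w c ≤? 1) ≡ suc (n * q₀)
  ball-size []               = refl
  ball-size {suc n} (x ∷ c) = begin
    ∑[ y < suc q₀ ] ∑ʷ (λ w → 𝟙 (dist (y ∷ w) (x ∷ c) ≤? 1))
      ≡⟨ sum-cong-≗ row ⟩
    ∑[ y < suc q₀ ] (𝟙 (y Fin.≟ x) * B + mismatch y x)
      ≡⟨ ∑-distrib-+ (λ y → 𝟙 (y Fin.≟ x) * B) (λ y → mismatch y x) ⟩
    ∑[ y < suc q₀ ] (𝟙 (y Fin.≟ x) * B) + ∑[ y < suc q₀ ] mismatch y x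
      ≡⟨ cong₂ _+_ (sym (*-distribʳ-sum B (λ y → 𝟙 (y Fin.≟ x)))) (∑-mismatch x) ⟩
    ∑[ y < suc q₀ ] 𝟙 (y Fin.≟ x) * B + q₀
      ≡⟨ cong (λ k → k * B + q₀) (∑-point x) ⟩
    1 * B + q₀
      ≡⟨ cong (_+ q₀) (trans (*-identityˡ B) (ball-size c)) ⟩
    suc (n * q₀) + q₀
      ≡⟨ cong suc (+-comm (n * q₀) q₀) ⟩
    suc (suc n * q₀)
      ∎
    where
    open ≡-Reasoning
    B = count (λ w → dist w c ≤? 1)
    row : ∀ y → ∑ʷ (λ w → 𝟙 (dist (y ∷ w) (x ∷ c) ≤? 1)) ≡ 𝟙 (y Fin.≟ x) * B + mismatch y x
    row y with y Fin.≟ x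
    ... | yes refl = sym (trans (+-identityʳ _) (*-identityˡ B))
    ... | no  _    = ∑ʷ-single (λ w → suc (dist w c) ≤? 1) c (s≤s (≤-reflexive (dist-refl c)))
                               (λ w d → dist≡0⇒≡ w c (n≤0⇒n≡0 (≤-pred d)))

  perfect-count : ∀ {n} {C : Code (suc q₀) n} (C? : Decidable C) → IsPerfect1 C →
                  count C? * suc (n * q₀) ≡ suc q₀ ^ n
  perfect-count {n} {C} C? perfect = begin
    count C? * suc (n * q₀)
      ≡⟨ *-distribʳ-∑ʷ _ (λ c → 𝟙 (C? c)) ⟩
    ∑ʷ (λ c → 𝟙 (C? c) * suc (n * q₀))
      ≡⟨ ∑ʷ-cong (λ c → cong (𝟙 (C? c) *_) (ball-size c)) ⟨
    ∑ʷ (λ c → 𝟙 (C? c) * ∑ʷ (λ w → 𝟙 (dist w c ≤? 1)))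
      ≡⟨ ∑ʷ-cong (λ c → *-distribˡ-∑ʷ (𝟙 (C? c)) (λ w → 𝟙 (dist w c ≤? 1))) ⟩
    ∑ʷ (λ c → ∑ʷ (λ w → 𝟙 (C? c) * 𝟙 (dist w c ≤? 1)))
      ≡⟨ ∑ʷ-comm (λ w c → 𝟙 (C? c) * 𝟙 (dist w c ≤? 1)) ⟨
    ∑ʷ (λ w → ∑ʷ (λ c → 𝟙 (C? c) * 𝟙 (dist w c ≤? 1)))
      ≡⟨ ∑ʷ-cong nearest ⟩
    ∑ʷ {n = n} (λ _ → 1)
      ≡⟨ trans (∑ʷ-const {suc q₀} {n} 1) (*-identityʳ _) ⟩
    suc q₀ ^ n
      ∎
    where
    open ≡-Reasoning
    nearest : ∀ w → ∑ʷ (λ c → 𝟙 (C? c) * 𝟙 (dist w c ≤? 1)) ≡ 1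
    nearest w = let c , (Cc , wc) , unique = perfect w in
      trans (∑ʷ-cong (λ c → sym (𝟙-×-dec (C? c) (dist w c ≤? 1))))
            (∑ʷ-single (λ c → C? c ×-dec (dist w c ≤? 1)) c (Cc , wc) (λ c′ (Cc′ , wc′) → unique c′ Cc′ wc′))

  IsPerfect1⇒IsCode : ∀ {n M} {C : Code (suc q₀) n} → IsPerfect1 C → M * suc (n * q₀) ≡ suc q₀ ^ n →
                      IsCode (suc q₀) n C M 3
  IsPerfect1⇒IsCode {n} {M} {C} perfect M-sphere =
    subst (HasSize C) count≡M (HasSize-count C?) , IsPerfect1⇒MinDist3 perfect
    where
    C? = IsPerfect1⇒Decidable perfect
    count≡M : count C? ≡ M
    count≡M = *-cancelʳ-≡ _ _ (suc (n * q₀)) (trans (perfect-count C? perfect) (sym M-sphere))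

-- Symbol sums modulo q and neighbours in M₀

module _ {q : ℕ} .{{_ : NonZero q}} where

  [m%q+n]%q≡[m+n]%q : ∀ m n → (m % q + n) % q ≡ (m + n) % q
  [m%q+n]%q≡[m+n]%q m n = begin
    (m % q + n) % q           ≡⟨ %-distribˡ-+ (m % q) n q ⟩
    (m % q % q + n % q) % q   ≡⟨ cong (λ k → (k + n % q) % q) (m%n%n≡m%n m q) ⟩
    (m % q + n % q) % q       ≡⟨ %-distribˡ-+ m n q ⟨
    (m + n) % q               ∎
    where open ≡-Reasoning

  q∣c+pred[q]*c : ∀ c → q ∣ c + pred q * c
  q∣c+pred[q]*c c = divides c (trans (cong (_* c) (suc-pred q)) (*-comm q c))

  +-cancelˡ-% : ∀ c x y → (c + x) % q ≡ (c + y) % q → x % q ≡ y % q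
  +-cancelˡ-% c x y eq = trans (sym (recover x)) (trans (cong (λ k → (k + pred q * c) % q) eq) (recover y))
    where
    recover : ∀ z → ((c + z) % q + pred q * c) % q ≡ z % q
    recover z = begin
      ((c + z) % q + pred q * c) % q  ≡⟨ [m%q+n]%q≡[m+n]%q (c + z) (pred q * c) ⟩
      (c + z + pred q * c) % q        ≡⟨ cong (_% q) (trans (cong (_+ pred q * c) (+-comm c z)) (+-assoc z c _)) ⟩
      (z + (c + pred q * c)) % q      ≡⟨ %-remove-+ʳ z (q∣c+pred[q]*c c) ⟩
      z % q                           ∎
      where open ≡-Reasoning

  toℕ%q : (x : Fin q) → toℕ x % q ≡ toℕ x
  toℕ%q x = m<n⇒m%n≡m (Finₚ.toℕ<n x)

  Fin-cancelʳ-% : ∀ c {x y : Fin q} → (toℕ x + c) % q ≡ (toℕ y + c) % q → x ≡ y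
  Fin-cancelʳ-% c {x} {y} eq = Finₚ.toℕ-injective (begin
    toℕ x                  ≡⟨ toℕ%q x ⟨
    toℕ x % q              ≡⟨ +-cancelˡ-% c (toℕ x) (toℕ y) (begin
      (c + toℕ x) % q        ≡⟨ cong (_% q) (+-comm c (toℕ x)) ⟩
      (toℕ x + c) % q        ≡⟨ eq ⟩
      (toℕ y + c) % q        ≡⟨ cong (_% q) (+-comm (toℕ y) c) ⟩
      (c + toℕ y) % q        ∎) ⟩
    toℕ y % q              ≡⟨ toℕ%q y ⟩
    toℕ y                  ∎)
    where open ≡-Reasoning

  _⊕_ : Fin q → ℕ → Fin q
  x ⊕ c = (toℕ x + c) mod q

  toℕ-⊕ : ∀ x c → toℕ (x ⊕ c) ≡ (toℕ x + c) % q
  toℕ-⊕ x c = Finₚ.toℕ-fromℕ< _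

  ⊕-cancelʳ : ∀ c {x y} → x ⊕ c ≡ y ⊕ c → x ≡ y
  ⊕-cancelʳ c {x} {y} eq = Fin-cancelʳ-% c (trans (sym (toℕ-⊕ x c)) (trans (cong toℕ eq) (toℕ-⊕ y c)))

  ⊕-comm : ∀ x y → x ⊕ toℕ y ≡ y ⊕ toℕ x
  ⊕-comm x y = Finₚ.toℕ-injective
    (trans (toℕ-⊕ x (toℕ y)) (trans (cong (_% q) (+-comm (toℕ x) (toℕ y))) (sym (toℕ-⊕ y (toℕ x)))))

  ⊕-cancelˡ : ∀ x → Injective _≡_ _≡_ (λ y → x ⊕ toℕ y)
  ⊕-cancelˡ x {y} {y′} eq = ⊕-cancelʳ (toℕ x) (trans (⊕-comm y x) (trans eq (⊕-comm x y′)))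

  ⊕-identityʳ : ∀ x → x ⊕ 0 ≡ x
  ⊕-identityʳ x = Finₚ.toℕ-injective (trans (toℕ-⊕ x 0) (trans (cong (_% q) (+-identityʳ (toℕ x))) (toℕ%q x)))

  ⊕-⊕-inverse : ∀ x {c d} → q ∣ c + d → (x ⊕ c) ⊕ d ≡ x
  ⊕-⊕-inverse x {c} {d} q∣c+d = Finₚ.toℕ-injective (begin
    toℕ ((x ⊕ c) ⊕ d)          ≡⟨ toℕ-⊕ (x ⊕ c) d ⟩
    (toℕ (x ⊕ c) + d) % q      ≡⟨ cong (λ k → (k + d) % q) (toℕ-⊕ x c) ⟩
    ((toℕ x + c) % q + d) % q  ≡⟨ [m%q+n]%q≡[m+n]%q (toℕ x + c) d ⟩
    (toℕ x + c + d) % q        ≡⟨ cong (_% q) (+-assoc (toℕ x) c d) ⟩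
    (toℕ x + (c + d)) % q      ≡⟨ %-remove-+ʳ (toℕ x) q∣c+d ⟩
    toℕ x % q                  ≡⟨ toℕ%q x ⟩
    toℕ x                      ∎)
    where open ≡-Reasoning

  negMod : ℕ → Fin q
  negMod c = (pred q * c) mod q

  [negMod+c]%q≡0 : ∀ c → (toℕ (negMod c) + c) % q ≡ 0
  [negMod+c]%q≡0 c = begin
    (toℕ (negMod c) + c) % q      ≡⟨ cong (λ k → (k + c) % q) (Finₚ.toℕ-fromℕ< _) ⟩
    ((pred q * c) % q + c) % q    ≡⟨ [m%q+n]%q≡[m+n]%q (pred q * c) c ⟩
    (pred q * c + c) % q          ≡⟨ cong (_% q) (+-comm (pred q * c) c) ⟩
    (c + pred q * c) % q          ≡⟨ n∣m⇒m%n≡0 _ q (q∣c+pred[q]*c c) ⟩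
    0                             ∎
    where open ≡-Reasoning

  sameSum⇒dist≢1 : ∀ {n} (x y : Word q n) → symSum x % q ≡ symSum y % q → dist x y ≢ 1
  sameSum⇒dist≢1 []      []      eq ()
  sameSum⇒dist≢1 (a ∷ x) (b ∷ y) eq d≡1 with a Fin.≟ b
  ... | yes refl = sameSum⇒dist≢1 x y (+-cancelˡ-% (toℕ a) _ _ eq) d≡1
  ... | no  a≢b with dist≡0⇒≡ x y (suc-injective d≡1)
  ...   | refl = a≢b (Fin-cancelʳ-% (symSum x) eq)

  sameSum-≢⇒2≤dist : ∀ {n} (x y : Word q n) → symSum x % q ≡ symSum y % q → x ≢ y → 2 ≤ dist x y
  sameSum-≢⇒2≤dist x y eq x≢y with dist x y in d
  ... | zero        = ⊥-elim (x≢y (dist≡0⇒≡ x y d))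
  ... | suc zero    = ⊥-elim (sameSum⇒dist≢1 x y eq d)
  ... | suc (suc _) = s≤s (s≤s z≤n)

  sameSum-dist≤1⇒≡ : ∀ {n} (x y : Word q n) → symSum x % q ≡ symSum y % q → dist x y ≤ 1 → x ≡ y
  sameSum-dist≤1⇒≡ x y eq d≤1 with x ≟ʷ y
  ... | yes x≡y = x≡y
  ... | no  x≢y = ⊥-elim (<⇒≱ (s≤s (s≤s z≤n)) (≤-trans (sameSum-≢⇒2≤dist x y eq x≢y) d≤1))

  symSum-insertAt : ∀ {n} (r : Word q n) (p : Fin (suc n)) (y : Fin q) → symSum (insertAt r p y) ≡ toℕ y + symSum r
  symSum-insertAt r       Fin.zero    y = refl
  symSum-insertAt (a ∷ r) (Fin.suc p) y =
    trans (cong (toℕ a +_) (symSum-insertAt r p y)) (x+[y+z]≡y+[x+z] (toℕ a) (toℕ y) (symSum r))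

  M₀-neighbour : ∀ {n} → Word q (suc n) → Fin (suc n) → Word q (suc n)
  M₀-neighbour u p = insertAt (removeAt u p) p (negMod (symSum (removeAt u p)))

  module _ {n} (u : Word q (suc n)) where

    M₀-neighbour-∈ : ∀ p → Mcode q (suc n) 0 (M₀-neighbour u p)
    M₀-neighbour-∈ p = trans (cong (_% q) (symSum-insertAt (removeAt u p) p _)) ([negMod+c]%q≡0 _)

    dist-M₀-neighbour≤1 : ∀ p → dist u (M₀-neighbour u p) ≤ 1
    dist-M₀-neighbour≤1 p = subst (λ x → dist x (M₀-neighbour u p) ≤ 1) (insertAt-removeAt u p)
      (subst (_≤ 1) (sym (dist-insertAt (removeAt u p) (removeAt u p) p (lookup u p) _))
                    (dist-sameTail≤1 (lookup u p) (negMod (symSum (removeAt u p))) (removeAt u p)))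

    lookup-M₀-neighbour : ∀ {r p} → r ≢ p → lookup (M₀-neighbour u r) p ≡ lookup u p
    lookup-M₀-neighbour {r} {p} r≢p = begin
      lookup (M₀-neighbour u r) p                     ≡⟨ cong (lookup (M₀-neighbour u r)) (Finₚ.punchIn-punchOut r≢p) ⟨
      lookup (M₀-neighbour u r) (punchIn r (punchOut r≢p)) ≡⟨ insertAt-punchIn (removeAt u r) r _ (punchOut r≢p) ⟩
      lookup (removeAt u r) (punchOut r≢p)            ≡⟨ removeAt-punchOut u r≢p ⟩
      lookup u p                                      ∎
      where open ≡-Reasoning

    -- For r ≢ p the neighbour at r keeps the letter of u at p, so if it equals the neighbour at p,
    -- the latter did not change u at all.
    M₀-neighbour-injective : ¬ Mcode q (suc n) 0 u → ∀ {p r} → M₀-neighbour u p ≡ M₀-neighbour u r → p ≡ r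
    M₀-neighbour-injective u∉M₀ {p} {r} eq with p Fin.≟ r
    ... | yes p≡r = p≡r
    ... | no  p≢r = ⊥-elim (u∉M₀ (subst (Mcode q (suc n) 0) neighbour≡u (M₀-neighbour-∈ p)))
      where
      neighbour≡u : M₀-neighbour u p ≡ u
      neighbour≡u = trans (cong (insertAt (removeAt u p) p) (begin
        negMod (symSum (removeAt u p))   ≡⟨ insertAt-lookup (removeAt u p) p _ ⟨
        lookup (M₀-neighbour u p) p      ≡⟨ cong (λ x → lookup x p) eq ⟩
        lookup (M₀-neighbour u r) p      ≡⟨ lookup-M₀-neighbour (p≢r ∘ sym) ⟩
        lookup u p                       ∎)) (insertAt-removeAt u p)
        where open ≡-Reasoning

  -- The n neighbours of u in M₀ lie in pairwise distinct classes, and there are exactly n classes.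
  M₀-partition-neighbour : ∀ {n} (D : Fin n → Code q n) → IsPartitionOf (Mcode q n 0) D → (∀ i → MinDist (D i) 3) →
                           ∀ u → ¬ Mcode q n 0 u → ∀ k → ∃[ w ] D k w × dist u w ≤ 1
  M₀-partition-neighbour {suc n} D (_ , cover , _) D-dist u u∉M₀ k =
    let p , class≡k = injective⇒surjective class class-injective k
    in M₀-neighbour u p , subst (λ i → D i (M₀-neighbour u p)) class≡k (∈class p) , dist-M₀-neighbour≤1 u p
    where
    class : Fin (suc n) → Fin (suc n)
    class p = proj₁ (cover (M₀-neighbour u p) (M₀-neighbour-∈ u p))
    ∈class : ∀ p → D (class p) (M₀-neighbour u p)
    ∈class p = proj₂ (cover (M₀-neighbour u p) (M₀-neighbour-∈ u p))
    class-injective : Injective _≡_ _≡_ class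
    class-injective {p} {r} eq = M₀-neighbour-injective u u∉M₀
      (MinDist3⇒uniqueNeighbour (D-dist (class p)) u (∈class p) (subst (λ i → D i (M₀-neighbour u r)) (sym eq) (∈class r))
                                (dist-M₀-neighbour≤1 u p) (dist-M₀-neighbour≤1 u r))

-- Isometries of H(n,q)

Isometric : Word q n ↔ Word q n → Set
Isometric σ = ∀ x y → dist (Inverse.to σ x) (Inverse.to σ y) ≡ dist x y

module _ (σ : Word q n ↔ Word q n) {C : Code q n} where
  open Inverse σ

  to-injective : ∀ {x y} → to x ≡ to y → x ≡ y
  to-injective {x} {y} eq = trans (sym (strictlyInverseʳ x)) (trans (cong from eq) (strictlyInverseʳ y))

  HasSize-preimage : ∀ {M} → HasSize C M → HasSize (C ∘ to) M
  HasSize-preimage (l , unique , len , mem) =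
    List.map from l , Uniqueₚ.map⁺ from-injective unique , trans (length-map from l) len , mem′
    where
    from-injective : ∀ {x y} → from x ≡ from y → x ≡ y
    from-injective {x} {y} eq = trans (sym (strictlyInverseˡ x)) (trans (cong to eq) (strictlyInverseˡ y))
    mem′ : ∀ x → (C (to x) → x ∈ List.map from l) × (x ∈ List.map from l → C (to x))
    mem′ x = (λ C[to-x] → subst (_∈ List.map from l) (strictlyInverseʳ x) (∈-map⁺ from (proj₁ (mem (to x)) C[to-x])))
           , (λ x∈ → let y , y∈l , x≡from-y = ∈-map⁻ from x∈
                     in subst C (sym (trans (cong to x≡from-y) (strictlyInverseˡ y))) (proj₂ (mem y) y∈l))

  module _ (isometric : Isometric σ) where

    MinDist-preimage : ∀ {d} → MinDist C d → MinDist (C ∘ to) d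
    MinDist-preimage minDist x y Cx Cy x≢y = subst (_ ≤_) (isometric x y) (minDist _ _ Cx Cy (x≢y ∘ to-injective))

    IsPerfect1-preimage : IsPerfect1 C → IsPerfect1 (C ∘ to)
    IsPerfect1-preimage perfect x =
      let c , (Cc , xc) , unique = perfect (to x)
      in from c
       , (subst C (sym (strictlyInverseˡ c)) Cc
       , subst (_≤ 1) (trans (cong (dist (to x)) (sym (strictlyInverseˡ c))) (isometric x (from c))) xc)
       , λ c′ Cc′ xc′ → trans (sym (strictlyInverseʳ c′))
                              (cong from (unique (to c′) Cc′ (subst (_≤ 1) (sym (isometric x c′)) xc′)))

module _ {q : ℕ} .{{_ : NonZero q}} {n : ℕ} where

  shiftHead : ℕ → Word q (suc n) → Word q (suc n)
  shiftHead c (x ∷ w) = x ⊕ c ∷ w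

  shiftHead-zero : ∀ w → shiftHead 0 w ≡ w
  shiftHead-zero (x ∷ w) = cong (_∷ w) (⊕-identityʳ x)

  shiftHead-↔ : ℕ → Word q (suc n) ↔ Word q (suc n)
  shiftHead-↔ c = mk↔ₛ′ (shiftHead c) (shiftHead (pred q * c))
    (λ { (x ∷ w) → cong (_∷ w) (⊕-⊕-inverse x (subst (q ∣_) (+-comm c (pred q * c)) (q∣c+pred[q]*c c))) })
    (λ { (x ∷ w) → cong (_∷ w) (⊕-⊕-inverse x (q∣c+pred[q]*c c)) })

  shiftHead-isometric : ∀ c → Isometric (shiftHead-↔ c)
  shiftHead-isometric c (x ∷ u) (y ∷ v) = begin
    dist (x ⊕ c ∷ u) (y ⊕ c ∷ v)         ≡⟨ dist-∷ (x ⊕ c) (y ⊕ c) u v ⟩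
    mismatch (x ⊕ c) (y ⊕ c) + dist u v  ≡⟨ cong (_+ dist u v) (𝟙-cong ≢⇔≢ (¬? (_ Fin.≟ _)) (¬? (x Fin.≟ y))) ⟩
    mismatch x y + dist u v              ≡⟨ dist-∷ x y u v ⟨
    dist (x ∷ u) (y ∷ v)                 ∎
    where
    open ≡-Reasoning
    ≢⇔≢ : (x ⊕ c ≢ y ⊕ c) ⇔ (x ≢ y)
    ≢⇔≢ = mk⇔ (λ ≢⊕ → ≢⊕ ∘ cong (_⊕ c)) (λ x≢y → x≢y ∘ ⊕-cancelʳ c)

  symSum-shiftHead : ∀ c w → symSum (shiftHead c w) % q ≡ (c + symSum w) % q
  symSum-shiftHead c (x ∷ u) = begin
    (toℕ (x ⊕ c) + symSum u) % q      ≡⟨ cong (λ k → (k + symSum u) % q) (toℕ-⊕ x c) ⟩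
    ((toℕ x + c) % q + symSum u) % q  ≡⟨ [m%q+n]%q≡[m+n]%q (toℕ x + c) (symSum u) ⟩
    (toℕ x + c + symSum u) % q        ≡⟨ cong (λ k → (k + symSum u) % q) (+-comm (toℕ x) c) ⟩
    (c + toℕ x + symSum u) % q        ≡⟨ cong (_% q) (+-assoc c (toℕ x) (symSum u)) ⟩
    (c + (toℕ x + symSum u)) % q      ∎
    where open ≡-Reasoning

moveTo : Fin (suc n) → Fin (suc n) → Word q (suc n) → Word q (suc n)
moveTo p j y = insertAt (removeAt y p) j (lookup y p)

moveTo-moveTo : ∀ p j (y : Word q (suc n)) → moveTo j p (moveTo p j y) ≡ y
moveTo-moveTo p j y =
  trans (cong₂ (λ r a → insertAt r p a) (removeAt-insertAt (removeAt y p) j (lookup y p))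
                                         (insertAt-lookup (removeAt y p) j (lookup y p)))
        (insertAt-removeAt y p)

moveTo-insertAt : ∀ p j (z : Word q n) a → moveTo p j (insertAt z p a) ≡ insertAt z j a
moveTo-insertAt p j z a = cong₂ (λ r b → insertAt r j b) (removeAt-insertAt z p a) (insertAt-lookup z p a)

moveTo-↔ : Fin (suc n) → Fin (suc n) → Word q (suc n) ↔ Word q (suc n)
moveTo-↔ p j = mk↔ₛ′ (moveTo p j) (moveTo j p) (moveTo-moveTo j p) (moveTo-moveTo p j)

moveTo-isometric : ∀ (p j : Fin (suc n)) → Isometric {q} (moveTo-↔ p j)
moveTo-isometric p j x y = begin
  dist (insertAt (removeAt x p) j (lookup x p)) (insertAt (removeAt y p) j (lookup y p))
    ≡⟨ dist-insertAt (removeAt x p) (removeAt y p) j (lookup x p) (lookup y p) ⟩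
  dist (lookup x p ∷ removeAt x p) (lookup y p ∷ removeAt y p)
    ≡⟨ dist-insertAt (removeAt x p) (removeAt y p) p (lookup x p) (lookup y p) ⟨
  dist (insertAt (removeAt x p) p (lookup x p)) (insertAt (removeAt y p) p (lookup y p))
    ≡⟨ cong₂ dist (insertAt-removeAt x p) (insertAt-removeAt y p) ⟩
  dist x y ∎
  where open ≡-Reasoning

IsShortening-moveTo : ∀ {C : Code q (suc n)} {j a S} p → IsShortening C j a S → IsShortening (C ∘ moveTo p j) p a S
IsShortening-moveTo {C = C} {j} {a} p short z =
    (λ Sz → subst C (sym (moveTo-insertAt p j z a)) (proj₁ (short z) Sz))
  , (λ C′z → proj₂ (short z) (subst C (moveTo-insertAt p j z a) C′z))

-- u ++ w, with its length written suc (k + l) as for the lengthened codes in IsShortening.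
join : ∀ {k l} → Word q k → Word q (suc l) → Word q (suc (k + l))
join []      w = w
join (x ∷ u) w = x ∷ join u w

joinPos : ∀ k {l} → Fin (suc l) → Fin (suc (k + l))
joinPos zero    j = j
joinPos (suc k) j = Fin.suc (joinPos k j)

insertAt-++ : ∀ {k l} (u : Word q k) (v : Word q l) j a → insertAt (u ++ v) (joinPos k j) a ≡ join u (insertAt v j a)
insertAt-++ []      v j a = refl
insertAt-++ (x ∷ u) v j a = cong (x ∷_) (insertAt-++ u v j a)

split-join : ∀ k {l} (x : Word q (suc (k + l))) → Σ (Word q k) λ u → Σ (Word q (suc l)) λ w → x ≡ join u w
split-join zero    x        = [] , x , refl
split-join (suc k) (y ∷ x) = let u , w , x≡uw = split-join k x in y ∷ u , w , cong (y ∷_) x≡uw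

join-injective : ∀ {k l} (u u′ : Word q k) {w w′ : Word q (suc l)} → join u w ≡ join u′ w′ → u ≡ u′ × w ≡ w′
join-injective []      []       eq = refl , eq
join-injective (x ∷ u) (y ∷ u′) eq with refl , eq′ ← ∷-injective eq =
  let u≡u′ , w≡w′ = join-injective u u′ eq′ in cong (x ∷_) u≡u′ , w≡w′

dist-join : ∀ {k l} (u u′ : Word q k) (w w′ : Word q (suc l)) → dist (join u w) (join u′ w′) ≡ dist u u′ + dist w w′
dist-join []      []       w w′ = refl
dist-join (x ∷ u) (y ∷ u′) w w′ = begin
  dist (x ∷ join u w) (y ∷ join u′ w′)        ≡⟨ dist-∷ x y (join u w) (join u′ w′) ⟩
  mismatch x y + dist (join u w) (join u′ w′) ≡⟨ cong (mismatch x y +_) (dist-join u u′ w w′) ⟩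
  mismatch x y + (dist u u′ + dist w w′)      ≡⟨ +-assoc (mismatch x y) _ _ ⟨
  mismatch x y + dist u u′ + dist w w′        ≡⟨ cong (_+ dist w w′) (dist-∷ x y u u′) ⟨
  dist (x ∷ u) (y ∷ u′) + dist w w′           ∎
  where open ≡-Reasoning

dist-join-sameˡ : ∀ {k l} (u : Word q k) (w w′ : Word q (suc l)) → dist (join u w) (join u w′) ≡ dist w w′
dist-join-sameˡ u w w′ = trans (dist-join u u w w′) (cong (_+ dist w w′) (dist-refl u))

dist-join-sameʳ : ∀ {k l} (u u′ : Word q k) (w : Word q (suc l)) → dist (join u w) (join u′ w) ≡ dist u u′
dist-join-sameʳ u u′ w = trans (dist-join u u′ w w) (trans (cong (dist u u′ +_) (dist-refl w)) (+-identityʳ _))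

PairwiseDisjoint : ∀ {N} → (Fin N → Code q n) → Set
PairwiseDisjoint P = ∀ i j x → P i x → P j x → i ≡ j

unionJoin : ∀ {N k l} → (Fin N → Code q k) → (Fin N → Code q (suc l)) → Code q (suc (k + l))
unionJoin D C x = ∃[ i ] Σ _ λ u → Σ _ λ w → D i u × C i w × x ≡ join u w

module _ {q N k l : ℕ} {D : Fin N → Code q k} where

  unionConcat-++ : ∀ {B : Fin N → Code q l} {u v} → unionConcat D B (u ++ v) → ∃[ i ] D i u × B i v
  unionConcat-++ {u = u} (i , u′ , v′ , Du′ , Bv′ , eq)
    with refl ← ++-injectiveˡ u u′ eq | refl ← ++-injectiveʳ u u′ eq = i , Du′ , Bv′

  unionConcat-map : ∀ {B : Fin N → Code q l} {D′ B′ z} →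
                    (∀ {i u} → D i u → D′ i u) → (∀ {i v} → B i v → B′ i v) →
                    unionConcat D B z → unionConcat D′ B′ z
  unionConcat-map f g (i , u , v , Du , Bv , eq) = i , u , v , f Du , g Bv , eq

  unionJoin-IsShortening : ∀ {B : Fin N → Code q l} {C j a} → (∀ i → IsShortening (C i) j a (B i)) →
                           IsShortening (unionJoin D C) (joinPos k j) a (unionConcat D B)
  unionJoin-IsShortening {B} {C} {j} {a} short z = to , from
    where
    to : unionConcat D B z → unionJoin D C (insertAt z (joinPos k j) a)
    to (i , u , v , Du , Bv , refl) = i , u , insertAt v j a , Du , proj₁ (short i v) Bv , insertAt-++ u v j a
    from : unionJoin D C (insertAt z (joinPos k j) a) → unionConcat D B z
    from (i , u′ , w′ , Du′ , Cw′ , eq) with u , v , refl ← splitAt k z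
      with refl , refl ← join-injective u u′ (trans (sym (insertAt-++ u v j a)) eq) =
      i , u , v , Du′ , proj₂ (short i v) Cw′ , refl

module _ {q N k l : ℕ} .{{_ : NonZero q}} {D : Fin N → Code q k} {B : Fin N → Code q l} where

  unionConcat-HasSize : ∀ {s t} → (∀ i → HasSize (D i) s) → (∀ i → HasSize (B i) t) → PairwiseDisjoint D →
                        HasSize (unionConcat D B) (N * (s * t))
  unionConcat-HasSize {s} {t} D-size B-size D-disj = subst (HasSize U) count≡ (HasSize-count U?)
    where
    U = unionConcat D B
    D? = λ i → HasSize⇒Decidable (D-size i)
    B? = λ i → HasSize⇒Decidable (B-size i)
    Q? : ∀ u v → Decidable (λ i → D i u × B i v)
    Q? u v i = D? i u ×-dec B? i v
    U? : Decidable U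
    U? z with u , v , refl ← splitAt k z =
      Dec.map (mk⇔ (λ (i , Du , Bv) → i , u , v , Du , Bv , refl) unionConcat-++) (Finₚ.any? (Q? u v))
    pointwise : ∀ (u : Word q k) (v : Word q l) → 𝟙 (U? (u ++ v)) ≡ ∑[ i < N ] (𝟙 (D? i u) * 𝟙 (B? i v))
    pointwise u v = begin
      𝟙 (U? (u ++ v))                     ≡⟨ 𝟙-cong (mk⇔ unionConcat-++ (λ (i , Du , Bv) → i , u , v , Du , Bv , refl))
                                                    (U? (u ++ v)) (Finₚ.any? (Q? u v)) ⟩
      𝟙 (Finₚ.any? (Q? u v))              ≡⟨ ∑-atMostOne (Q? u v) (λ i j (Du , _) (Du′ , _) → D-disj i j u Du Du′) ⟨
      ∑[ i < N ] 𝟙 (Q? u v i)             ≡⟨ sum-cong-≗ (λ i → 𝟙-×-dec (D? i u) (B? i v)) ⟩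
      ∑[ i < N ] (𝟙 (D? i u) * 𝟙 (B? i v)) ∎
      where open ≡-Reasoning
    count≡ : count U? ≡ N * (s * t)
    count≡ = begin
      count U?
        ≡⟨ ∑ʷ-++ {q} {k} {l} (λ z → 𝟙 (U? z)) ⟩
      ∑ʷ {n = k} (λ u → ∑ʷ {n = l} (λ v → 𝟙 (U? (u ++ v))))
        ≡⟨ ∑ʷ-cong (λ u → ∑ʷ-cong (pointwise u)) ⟩
      ∑ʷ {n = k} (λ u → ∑ʷ {n = l} (λ v → ∑[ i < N ] (𝟙 (D? i u) * 𝟙 (B? i v))))
        ≡⟨ ∑ʷ-cong (λ u → ∑ʷ-∑-comm (λ v i → 𝟙 (D? i u) * 𝟙 (B? i v))) ⟩
      ∑ʷ {n = k} (λ u → ∑[ i < N ] ∑ʷ {n = l} (λ v → 𝟙 (D? i u) * 𝟙 (B? i v)))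
        ≡⟨ ∑ʷ-∑-comm (λ u i → ∑ʷ (λ v → 𝟙 (D? i u) * 𝟙 (B? i v))) ⟩
      ∑[ i < N ] ∑ʷ {n = k} (λ u → ∑ʷ {n = l} (λ v → 𝟙 (D? i u) * 𝟙 (B? i v)))
        ≡⟨ sum-cong-≗ (λ i → ∑ʷ-product (λ u → 𝟙 (D? i u)) (λ v → 𝟙 (B? i v))) ⟩
      ∑[ i < N ] (count (D? i) * count (B? i))
        ≡⟨ sum-cong-≗ (λ i → cong₂ _*_ (HasSize⇒≡count (D-size i) (D? i)) (HasSize⇒≡count (B-size i) (B? i))) ⟨
      ∑[ i < N ] (s * t)
        ≡⟨ ∑-const N (s * t) ⟩
      N * (s * t) ∎
      where open ≡-Reasoning

  -- Words from different classes have distinct prefixes with equal sums mod q, hence at distance at least 2.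
  unionConcat-MinDist3 : (∀ i → MinDist (D i) 3) → (∀ i → MinDist (B i) 3) →
                         (∀ {i j u u′} → D i u → D j u′ → symSum u % q ≡ symSum u′ % q) →
                         PairwiseDisjoint D → PairwiseDisjoint B → MinDist (unionConcat D B) 3
  unionConcat-MinDist3 D-dist B-dist sameSum D-disj B-disj _ _
    (i , u , v , Du , Bv , refl) (j , u′ , v′ , Du′ , Bv′ , refl) uv≢u′v′ rewrite dist-++ u u′ v v′ with i Fin.≟ j
  ... | no i≢j = +-mono-≤ (sameSum-≢⇒2≤dist u u′ (sameSum Du Du′) (λ { refl → i≢j (D-disj i j u Du Du′) }))
                          (≢⇒1≤dist v v′ (λ { refl → i≢j (B-disj i j v Bv Bv′) }))
  ... | yes refl with u ≟ʷ u′
  ...   | yes refl = ≤-trans (B-dist i v v′ Bv Bv′ (uv≢u′v′ ∘ cong (u ++_))) (m≤n+m _ _)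
  ...   | no  u≢u′ = ≤-trans (D-dist i u u′ Du Du′ u≢u′) (m≤m+n _ _)

  unionConcat-IsCode : ∀ {s t} → (∀ i → IsCode q k (D i) s 3) → (∀ i → IsCode q l (B i) t 3) →
                       (∀ {i j u u′} → D i u → D j u′ → symSum u % q ≡ symSum u′ % q) →
                       PairwiseDisjoint D → PairwiseDisjoint B → IsCode q (k + l) (unionConcat D B) (N * (s * t)) 3
  unionConcat-IsCode D-code B-code sameSum D-disj B-disj =
      unionConcat-HasSize (proj₁ ∘ D-code) (proj₁ ∘ B-code) D-disj
    , unionConcat-MinDist3 (proj₂ ∘ D-code) (proj₂ ∘ B-code) sameSum D-disj B-disj

-- Perfect lengthenings

UniquelyCovered : Code q n → Word q n → Set
UniquelyCovered {q} {n} C x = Σ (Word q n) λ c → (C c × dist x c ≤ 1) × (∀ c′ → C c′ → dist x c′ ≤ 1 → c′ ≡ c)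

module Lengthening {q N l : ℕ} .{{_ : NonZero q}}
  {D : Fin N → Code q N} (D-part : IsPartitionOf (Mcode q N 0) D) (D-dist : ∀ i → MinDist (D i) 3)
  {C : Fin N → Code q (suc l)} (C-part : IsPartitionOf Whole C) (C-perfect : ∀ i → IsPerfect1 (C i)) where

  private
    L = unionJoin D C
    D⊆M₀ = proj₁ D-part
    D-cover = proj₁ (proj₂ D-part)
    D-disj = proj₂ (proj₂ D-part)
    C-cover = proj₁ (proj₂ C-part)
    C-disj = proj₂ (proj₂ C-part)

  covered-from-M₀ : ∀ u w → Mcode q N 0 u → UniquelyCovered L (join u w)
  covered-from-M₀ u w u∈M₀
    with i , Du ← D-cover u u∈M₀
    with c , (Cc , wc) , unique ← C-perfect i w
    = join u c , ((i , u , c , Du , Cc , refl) , subst (_≤ 1) (sym (dist-join-sameˡ u w c)) wc) , unique′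
    where
    unique′ : ∀ x → L x → dist (join u w) x ≤ 1 → x ≡ join u c
    unique′ _ (i′ , u′ , w′ , Du′ , Cw′ , refl) d≤1
      with uu′ , ww′ ← +≤1⇒≤1 (dist u u′) (subst (_≤ 1) (dist-join u u′ w w′) d≤1)
      with refl ← sameSum-dist≤1⇒≡ u u′ (trans u∈M₀ (sym (D⊆M₀ i′ u′ Du′))) uu′
      with refl ← D-disj i i′ u Du Du′
      = cong (join u) (unique w′ Cw′ ww′)

  covered-outside-M₀ : ∀ u w → ¬ Mcode q N 0 u → UniquelyCovered L (join u w)
  covered-outside-M₀ u w u∉M₀
    with k , Cw ← C-cover w tt
    with w₀ , Dw₀ , uw₀ ← M₀-partition-neighbour D D-part D-dist u u∉M₀ k
    = join w₀ w , ((k , w₀ , w , Dw₀ , Cw , refl) , subst (_≤ 1) (sym (dist-join-sameʳ u w₀ w)) uw₀) , unique′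
    where
    unique′ : ∀ x → L x → dist (join u w) x ≤ 1 → x ≡ join w₀ w
    unique′ _ (i′ , u′ , w′ , Du′ , Cw′ , refl) d≤1
      with d≤1′ ← subst (_≤ 1) (dist-join u u′ w w′) d≤1
      with uu′ , _ ← +≤1⇒≤1 (dist u u′) d≤1′
      with refl ← dist≡0⇒≡ w w′ (1≤m⇒m+n≤1⇒n≡0 (≢⇒1≤dist u u′ (λ { refl → u∉M₀ (D⊆M₀ i′ u Du′) })) d≤1′)
      with refl ← C-disj i′ k w Cw′ Cw
      = cong (λ x → join x w) (MinDist3⇒uniqueNeighbour (D-dist k) u Du′ Dw₀ uu′ uw₀)

  unionJoin-perfect : IsPerfect1 L
  unionJoin-perfect x with u , w , refl ← split-join N x with symSum u % q ≟ℕ 0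
  ... | yes u∈M₀ = covered-from-M₀ u w u∈M₀
  ... | no  u∉M₀ = covered-outside-M₀ u w u∉M₀

module Shortening {q N l : ℕ} .{{_ : NonZero q}}
  {D : Fin N → Code q N} (D-part : IsPartitionOf (Mcode q N 0) D) (D-dist : ∀ i → MinDist (D i) 3)
  {B : Fin N → Code q l} (B-part : IsPartitionOf Whole B)
  {C : Code q (suc (N + l))} (C-perfect : IsPerfect1 C)
  {a : Fin q} (C-short : IsShortening C (joinPos N Fin.zero) a (unionConcat D B))
  (u* : Word q N) (u*∉M₀ : ¬ Mcode q N 0 u*) where

  private
    D⊆M₀ = proj₁ D-part
    D-cover = proj₁ (proj₂ D-part)
    D-disj = proj₂ (proj₂ D-part)
    B-cover = proj₁ (proj₂ B-part)

  C-join : ∀ u v → C (join u (a ∷ v)) ⇔ unionConcat D B (u ++ v)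
  C-join u v = mk⇔ (λ Cuav → proj₂ (C-short (u ++ v)) (subst C (sym (insertAt-++ u v Fin.zero a)) Cuav))
                   (λ Suv → subst C (insertAt-++ u v Fin.zero a) (proj₁ (C-short (u ++ v)) Suv))

  -- If u ∉ M₀, take v ∈ Bₖ and the neighbour u′ of u in Dₖ: the codewords u (b v) and u′ (a v) are both
  -- adjacent to u (a v), so u = u′ ∈ M₀.
  prefix∈M₀ : ∀ u w → C (join u w) → Mcode q N 0 u
  prefix∈M₀ u (b ∷ v) Cubv with symSum u % q ≟ℕ 0
  ... | yes u∈M₀ = u∈M₀
  ... | no  u∉M₀
    with k , Bv ← B-cover v tt
    with u′ , Du′ , uu′ ← M₀-partition-neighbour D D-part D-dist u u∉M₀ k
    with refl , _ ← join-injective u u′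
           (IsPerfect1⇒uniqueNeighbour C-perfect (join u (a ∷ v)) Cubv
              (Equivalence.from (C-join u′ v) (k , u′ , v , Du′ , Bv , refl))
              (subst (_≤ 1) (sym (dist-join-sameˡ u (a ∷ v) (b ∷ v))) (dist-sameTail≤1 a b v))
              (subst (_≤ 1) (sym (dist-join-sameʳ u u′ (a ∷ v))) uu′))
    = D⊆M₀ k u Du′

  private
    anchorNeighbour : ∀ k → ∃[ w ] D k w × dist u* w ≤ 1
    anchorNeighbour = M₀-partition-neighbour D D-part D-dist u* u*∉M₀

  anchor : Fin N → Word q N
  anchor k = proj₁ (anchorNeighbour k)

  anchor∈D : ∀ k → D k (anchor k)
  anchor∈D k = proj₁ (proj₂ (anchorNeighbour k))

  dist-anchor≤1 : ∀ k → dist u* (anchor k) ≤ 1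
  dist-anchor≤1 k = proj₂ (proj₂ (anchorNeighbour k))

  slice : Fin N → Code q (suc l)
  slice k w = C (join (anchor k) w)

  slice-IsShortening : ∀ k → IsShortening (slice k) Fin.zero a (B k)
  slice-IsShortening k v = to , from
    where
    to : B k v → slice k (a ∷ v)
    to Bv = Equivalence.from (C-join (anchor k) v) (k , anchor k , v , anchor∈D k , Bv , refl)
    from : slice k (a ∷ v) → B k v
    from c with i , Du , Bv ← unionConcat-++ (Equivalence.to (C-join (anchor k) v) c)
           with refl ← D-disj i k (anchor k) Du (anchor∈D k) = Bv

  slice-perfect : ∀ k → IsPerfect1 (slice k)
  slice-perfect k w
    with c , (Cc , yc) , unique ← C-perfect (join (anchor k) w)
    with u′ , w′ , refl ← split-join N c
    with uu′ , ww′ ← +≤1⇒≤1 (dist (anchor k) u′) (subst (_≤ 1) (dist-join (anchor k) u′ w w′) yc)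
    with refl ← sameSum-dist≤1⇒≡ (anchor k) u′ (trans (D⊆M₀ k _ (anchor∈D k)) (sym (prefix∈M₀ u′ w′ Cc))) uu′
    = w′ , (Cc , ww′) , λ c′ Cc′ wc′ →
        proj₂ (join-injective (anchor k) (anchor k)
                 (unique (join (anchor k) c′) Cc′ (subst (_≤ 1) (sym (dist-join-sameˡ (anchor k) w c′)) wc′)))

  slice-cover : ∀ w → ∃[ k ] slice k w
  slice-cover w
    with c , (Cc , yc) , _ ← C-perfect (join u* w)
    with u′ , w′ , refl ← split-join N c
    with d≤1 ← subst (_≤ 1) (dist-join u* u′ w w′) yc
    with u′∈M₀ ← prefix∈M₀ u′ w′ Cc
    with refl ← dist≡0⇒≡ w w′ (1≤m⇒m+n≤1⇒n≡0 (≢⇒1≤dist u* u′ (λ { refl → u*∉M₀ u′∈M₀ })) d≤1)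
    with k , Du′ ← D-cover u′ u′∈M₀
    with u*u′ , _ ← +≤1⇒≤1 (dist u* u′) d≤1
    with refl ← MinDist3⇒uniqueNeighbour (D-dist k) u* Du′ (anchor∈D k) u*u′ (dist-anchor≤1 k)
    = k , Cc

  slice-disjoint : PairwiseDisjoint slice
  slice-disjoint i k w Cᵢw Cₖw = D-disj i k (anchor i) (anchor∈D i) (subst (D k) (sym anchorᵢ≡anchorₖ) (anchor∈D k))
    where
    near : ∀ j → dist (join u* w) (join (anchor j) w) ≤ 1
    near j = subst (_≤ 1) (sym (dist-join-sameʳ u* (anchor j) w)) (dist-anchor≤1 j)
    anchorᵢ≡anchorₖ : anchor i ≡ anchor k
    anchorᵢ≡anchorₖ = proj₁ (join-injective (anchor i) (anchor k)
                              (IsPerfect1⇒uniqueNeighbour C-perfect (join u* w) Cᵢw Cₖw (near i) (near k)))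

  slice-partition : IsPartitionOf Whole slice
  slice-partition = (λ _ _ _ → tt) , (λ w _ → slice-cover w) , slice-disjoint

-- A partition of H(n-1,q) containing S

module Partition {q₀ N₀ l : ℕ}
  {D : Fin (suc N₀) → Code (suc q₀) (suc N₀)} (D-part : IsPartitionOf (Mcode (suc q₀) (suc N₀) 0) D)
  {B : Fin (suc N₀) → Code (suc q₀) l} (B-part : IsPartitionOf Whole B) where

  private
    D⊆M₀ = proj₁ D-part
    D-cover = proj₁ (proj₂ D-part)
    D-disj = proj₂ (proj₂ D-part)
    B-cover = proj₁ (proj₂ B-part)
    B-disj = proj₂ (proj₂ B-part)

  translate : Fin (suc q₀) → Fin (suc N₀) → Code (suc q₀) (suc N₀)
  translate a i = D i ∘ shiftHead (toℕ a)

  rotate : Fin (suc N₀) → Fin (suc N₀) → Code (suc q₀) l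
  rotate k i = B (i ⊕ toℕ k)

  part : Fin (suc q₀) → Fin (suc N₀) → Code (suc q₀) (suc N₀ + l)
  part a k = unionConcat (translate a) (rotate k)

  translate-sum : ∀ {a i u} → translate a i u → (toℕ a + symSum u) % (suc q₀) ≡ 0
  translate-sum {a} {i} {u} Du = trans (sym (symSum-shiftHead (toℕ a) u)) (D⊆M₀ i _ Du)

  part-IsCode : ∀ {s t} → (∀ i → IsCode (suc q₀) (suc N₀) (D i) s 3) → (∀ i → IsCode (suc q₀) l (B i) t 3) →
                ∀ a k → IsCode (suc q₀) (suc N₀ + l) (part a k) ((suc N₀) * (s * t)) 3
  part-IsCode {s} D-code B-code a k =
    unionConcat-IsCode translate-IsCode (λ i → B-code (i ⊕ toℕ k)) sameSum
                       (λ i j u → D-disj i j (shiftHead (toℕ a) u))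
                       (λ i j v Bᵢ Bⱼ → ⊕-cancelʳ (toℕ k) (B-disj _ _ v Bᵢ Bⱼ))
    where
    σ = shiftHead-↔ (toℕ a)
    translate-IsCode : ∀ i → IsCode (suc q₀) (suc N₀) (translate a i) s 3
    translate-IsCode i = HasSize-preimage σ (proj₁ (D-code i))
                       , MinDist-preimage σ (shiftHead-isometric (toℕ a)) (proj₂ (D-code i))
    sameSum : ∀ {i j u u′} → translate a i u → translate a j u′ → symSum u % (suc q₀) ≡ symSum u′ % (suc q₀)
    sameSum Du Du′ = +-cancelˡ-% (toℕ a) _ _ (trans (translate-sum Du) (sym (translate-sum Du′)))

  part-cover-++ : ∀ (u : Word (suc q₀) (suc N₀)) (v : Word (suc q₀) l) → ∃[ a ] ∃[ k ] part a k (u ++ v)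
  part-cover-++ u v
    with i , Dᵢ ← D-cover (shiftHead (toℕ (negMod (symSum u))) u)
                          (trans (symSum-shiftHead (toℕ (negMod (symSum u))) u) ([negMod+c]%q≡0 {(suc q₀)} (symSum u)))
    with j , Bⱼ ← B-cover v tt
    with k , i⊕k≡j ← injective⇒surjective (λ k → i ⊕ toℕ k) (⊕-cancelˡ i) j
    = negMod (symSum u) , k , i , u , v , Dᵢ , subst (λ t → B t v) (sym i⊕k≡j) Bⱼ , refl

  part-cover : ∀ z → ∃[ a ] ∃[ k ] part a k z
  part-cover z with u , v , refl ← splitAt (suc N₀) z = part-cover-++ u v

  part-disjoint : ∀ {a k a′ k′ z} → part a k z → part a′ k′ z → (a , k) ≡ (a′ , k′)
  part-disjoint {a} {a′ = a′} (i , u , v , Du , Bv , refl) (i′ , u′ , v′ , Du′ , Bv′ , eq)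
    with refl ← ++-injectiveˡ u u′ eq | refl ← ++-injectiveʳ u u′ eq
    with refl ← Fin-cancelʳ-% (symSum u) {a} {a′} (trans (translate-sum Du) (sym (translate-sum Du′)))
    with refl ← D-disj i i′ _ Du Du′
    with refl ← ⊕-cancelˡ i (B-disj _ _ v Bv Bv′)
    = refl

  part-zero : ∀ z → part Fin.zero Fin.zero z ⇔ unionConcat D B z
  part-zero z = mk⇔ (unionConcat-map (subst (D _) (shiftHead-zero _)) (subst (λ i → B i _) (⊕-identityʳ _)))
                    (unionConcat-map (subst (D _) (sym (shiftHead-zero _))) (subst (λ i → B i _) (sym (⊕-identityʳ _))))

  module _ {M} (index : Fin M ↔ (Fin (suc q₀) × Fin (suc N₀))) where
    open Inverse index

    partition : Fin M → Code (suc q₀) (suc N₀ + l)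
    partition x = uncurry part (to x)

    partition-IsPartition : IsPartitionOf Whole partition
    partition-IsPartition = (λ _ _ _ → tt) , cover , disjoint
      where
      cover : ∀ z → Whole z → ∃[ x ] partition x z
      cover z _ = let a , k , Pz = part-cover z in
        from (a , k) , subst (λ ak → uncurry part ak z) (sym (strictlyInverseˡ (a , k))) Pz
      disjoint : ∀ x x′ z → partition x z → partition x′ z → x ≡ x′
      disjoint x x′ z Pz P′z = trans (sym (strictlyInverseʳ x)) (trans (cong from (part-disjoint Pz P′z)) (strictlyInverseʳ x′))

    partition-zero : ∀ z → (partition (from (Fin.zero , Fin.zero)) z → unionConcat D B z)
                           × (unionConcat D B z → partition (from (Fin.zero , Fin.zero)) z)
    partition-zero z =
        (λ Pz → Equivalence.to (part-zero z) (subst (λ ak → uncurry part ak z) (strictlyInverseˡ _) Pz))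
      , (λ Sz → subst (λ ak → uncurry part ak z) (sym (strictlyInverseˡ _)) (Equivalence.from (part-zero z) Sz))

HasSize-1⇒[] : {P : Code q 0} → HasSize P 1 → P []
HasSize-1⇒[] ([] List.∷ List.[] , _ , _ , mem) = proj₂ (mem []) (here refl)

no-partition-of-a-point : ∀ {N} (B : Fin (suc (suc N)) → Code q 0) → PairwiseDisjoint B → (∀ i → HasSize (B i) 1) → ⊥
no-partition-of-a-point B B-disj B-size =
  Finₚ.0≢1+n (B-disj Fin.zero (Fin.suc Fin.zero) [] (HasSize-1⇒[] (B-size _)) (HasSize-1⇒[] (B-size _)))

symSum-replicate-zero : ∀ {q₀} k → symSum (replicate k (Fin.zero {suc q₀})) ≡ 0
symSum-replicate-zero zero    = refl
symSum-replicate-zero (suc k) = symSum-replicate-zero k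

e₁ : ∀ {r N₀} → Word (suc (suc r)) (suc N₀)
e₁ {N₀ = N₀} = Fin.suc Fin.zero ∷ replicate N₀ Fin.zero

e₁∉M₀ : ∀ {r N₀} → ¬ Mcode (suc (suc r)) (suc N₀) 0 e₁
e₁∉M₀ {r} {N₀} e₁∈M₀ = 1+n≢0 (trans (cong (λ s → suc s % suc (suc r)) (sym (symSum-replicate-zero N₀))) e₁∈M₀)

suc[[q∸1]*n]≡q^k : ∀ {q n} k .{{_ : NonZero q}} → (q ∸ 1) * n ≡ q ^ k ∸ 1 → suc ((q ∸ 1) * n) ≡ q ^ k
suc[[q∸1]*n]≡q^k {q} k eq = trans (cong suc eq) (suc-pred (q ^ k) {{m^n≢0 q k}})

length-split : ∀ {q₀ n n′} k .{{_ : NonZero q₀}} →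
               q₀ * n ≡ suc q₀ ^ suc k ∸ 1 → q₀ * n′ ≡ suc q₀ ^ k ∸ 1 → n ≡ suc q₀ ^ k + n′
length-split {q₀} {n} {n′} k hn hn′ = *-cancelˡ-≡ n (suc q₀ ^ k + n′) q₀ (suc-injective (begin
  suc (q₀ * n)                      ≡⟨ suc[[q∸1]*n]≡q^k (suc k) hn ⟩
  suc q₀ ^ k + q₀ * suc q₀ ^ k      ≡⟨ cong (_+ q₀ * suc q₀ ^ k) (suc[[q∸1]*n]≡q^k k hn′) ⟨
  suc (q₀ * n′ + q₀ * suc q₀ ^ k)   ≡⟨ cong suc (+-comm (q₀ * n′) _) ⟩
  suc (q₀ * suc q₀ ^ k + q₀ * n′)   ≡⟨ cong suc (*-distribˡ-+ q₀ (suc q₀ ^ k) n′) ⟨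
  suc (q₀ * (suc q₀ ^ k + n′))      ∎))
  where open ≡-Reasoning

k<[1+q₀]^k : ∀ {q₀} .{{_ : NonZero q₀}} k → k < suc q₀ ^ k
k<[1+q₀]^k         zero    = s≤s z≤n
k<[1+q₀]^k {q₀} (suc k) = subst (_≤ suc q₀ ^ suc k) (+-comm (suc k) 1)
  (+-mono-≤ (k<[1+q₀]^k k) (*-mono-≤ (>-nonZero⁻¹ q₀) (m^n>0 (suc q₀) k)))

[1+r]*k+2≤[2+r]^k : ∀ r k → suc r * suc (suc k) + 2 ≤ suc (suc r) ^ suc (suc k)
[1+r]*k+2≤[2+r]^k r zero    = ≤-trans (m≤m+n _ (r * suc (suc r))) (≤-reflexive (sym (square r)))
  where
  square : ∀ r → suc (suc r) * (suc (suc r) * 1) ≡ (suc r * 2 + 2) + r * suc (suc r)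
  square = solve-∀
[1+r]*k+2≤[2+r]^k r (suc k) = begin
  suc r * suc (suc (suc k)) + 2
    ≡⟨ shift r k ⟩
  (suc r * suc (suc k) + 2) + suc r * 1
    ≤⟨ +-mono-≤ ([1+r]*k+2≤[2+r]^k r k) (*-monoʳ-≤ (suc r) (m^n>0 (suc (suc r)) (suc (suc k)))) ⟩
  suc (suc r) ^ suc (suc (suc k))
    ∎
  where
  open ≤-Reasoning
  shift : ∀ r k → suc r * suc (suc (suc k)) + 2 ≡ (suc r * suc (suc k) + 2) + suc r * 1
  shift = solve-∀

n′-large : ∀ {r n′} k → suc r * n′ ≡ suc (suc r) ^ suc (suc k) ∸ 1 → suc (suc (suc k)) ≤ n′
n′-large {r} {n′} k hn′ = *-cancelˡ-< (suc r) (suc (suc k)) n′ (begin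
  suc (suc r * suc (suc k))     ≡⟨ +-comm 1 (suc r * suc (suc k)) ⟩
  suc r * suc (suc k) + 1       ≤⟨ ≤-pred (begin
    suc (suc r * suc (suc k) + 1) ≡⟨ +-suc (suc r * suc (suc k)) 1 ⟨
    suc r * suc (suc k) + 2       ≤⟨ [1+r]*k+2≤[2+r]^k r k ⟩
    suc (suc r) ^ suc (suc k)     ≡⟨ suc[[q∸1]*n]≡q^k (suc (suc k)) hn′ ⟨
    suc (suc r * n′)              ∎) ⟩
  suc r * n′                    ∎)
  where open ≤-Reasoning

perfect-size : ∀ {q₀ n m} → q₀ * n ≡ suc q₀ ^ m ∸ 1 → m ≤ n → suc q₀ ^ (n ∸ m) * suc (n * q₀) ≡ suc q₀ ^ n
perfect-size {q₀} {n} {m} hn m≤n = begin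
  suc q₀ ^ (n ∸ m) * suc (n * q₀)  ≡⟨ cong (λ x → suc q₀ ^ (n ∸ m) * suc x) (*-comm n q₀) ⟩
  suc q₀ ^ (n ∸ m) * suc (q₀ * n)  ≡⟨ cong (suc q₀ ^ (n ∸ m) *_) (suc[[q∸1]*n]≡q^k m hn) ⟩
  suc q₀ ^ (n ∸ m) * suc q₀ ^ m    ≡⟨ ^-distribˡ-+-* (suc q₀) (n ∸ m) m ⟨
  suc q₀ ^ (n ∸ m + m)             ≡⟨ cong (suc q₀ ^_) (m∸n+n≡m m≤n) ⟩
  suc q₀ ^ n                       ∎
  where open ≡-Reasoning

size-identity : ∀ {q k N l} → N ≡ q ^ k → suc k ≤ N → k ≤ l →
                N * (q ^ (N ∸ suc k) * q ^ (l ∸ k)) ≡ q ^ (N + l ∸ suc k)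
size-identity {q} {k} N≡q^k sk≤N k≤l
  with a , refl ← m≤n⇒∃[o]m+o≡n sk≤N | b , refl ← m≤n⇒∃[o]m+o≡n k≤l = begin
  (suc k + a) * (q ^ (suc k + a ∸ suc k) * q ^ (k + b ∸ k))
    ≡⟨ cong₂ (λ x y → (suc k + a) * (q ^ x * q ^ y)) (m+n∸m≡n (suc k) a) (m+n∸m≡n k b) ⟩
  (suc k + a) * (q ^ a * q ^ b)     ≡⟨ cong (_* (q ^ a * q ^ b)) N≡q^k ⟩
  q ^ k * (q ^ a * q ^ b)           ≡⟨ cong (q ^ k *_) (^-distribˡ-+-* q a b) ⟨
  q ^ k * q ^ (a + b)               ≡⟨ ^-distribˡ-+-* q k (a + b) ⟨
  q ^ (k + (a + b))                 ≡⟨ cong (q ^_) (x+[y+z]≡y+[x+z] k a b) ⟩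
  q ^ (a + (k + b))                 ≡⟨ cong (q ^_) (m+n∸m≡n (suc k) (a + (k + b))) ⟨
  q ^ (suc k + (a + (k + b)) ∸ suc k) ≡⟨ cong (λ x → q ^ (x ∸ suc k)) (+-assoc (suc k) a (k + b)) ⟨
  q ^ (suc k + a + (k + b) ∸ suc k) ∎
  where open ≡-Reasoning

module Construction {q₀ k N₀ l : ℕ} .{{_ : NonZero q₀}}
  (N≡q^k : suc N₀ ≡ suc q₀ ^ k) (k≤l : k ≤ l)
  (hn′ : q₀ * suc l ≡ suc q₀ ^ k ∸ 1) (hn : q₀ * suc (suc N₀ + l) ≡ suc q₀ ^ suc k ∸ 1)
  {B : Fin (suc N₀) → Code (suc q₀) l} (B-part : IsPartitionOf Whole B)
  (B-code : ∀ i → IsCode (suc q₀) l (B i) (suc q₀ ^ (l ∸ k)) 3)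
  {D : Fin (suc N₀) → Code (suc q₀) (suc N₀)} (D-part : IsPartitionOf (Mcode (suc q₀) (suc N₀) 0) D)
  (D-code : ∀ i → IsCode (suc q₀) (suc N₀) (D i) (suc q₀ ^ (suc N₀ ∸ suc k)) 3)
  (u* : Word (suc q₀) (suc N₀)) (u*∉M₀ : ¬ Mcode (suc q₀) (suc N₀) 0 u*)
  where

  private
    S = unionConcat D B
    D-dist = λ i → proj₂ (D-code i)
    sk≤N : suc k ≤ suc N₀
    sk≤N = subst (suc k ≤_) (sym N≡q^k) (k<[1+q₀]^k k)
    S-size : suc N₀ * (suc q₀ ^ (suc N₀ ∸ suc k) * suc q₀ ^ (l ∸ k)) ≡ suc q₀ ^ (suc N₀ + l ∸ suc k)
    S-size = size-identity N≡q^k sk≤N k≤l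

  PerfectLengthening : Set₁
  PerfectLengthening = Σ (Code (suc q₀) (suc (suc N₀ + l))) λ C →
    IsPerfect1 C × IsCode (suc q₀) (suc (suc N₀ + l)) C (suc q₀ ^ (suc (suc N₀ + l) ∸ suc k)) 3
    × ∃[ j ] ∃[ a ] IsShortening C j a S

  PerfectLengthenings : Set₁
  PerfectLengthenings = Σ (Fin (suc N₀) → Code (suc q₀) (suc l)) λ C →
    (∃[ j ] ∃[ a ] (∀ i → IsShortening (C i) j a (B i)))
    × (∀ i → IsPerfect1 (C i) × IsCode (suc q₀) (suc l) (C i) (suc q₀ ^ (suc l ∸ k)) 3)
    × IsPartitionOf Whole C

  S-IsCode : IsCode (suc q₀) (suc N₀ + l) S (suc q₀ ^ (suc N₀ + l ∸ suc k)) 3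
  S-IsCode = subst (λ M → IsCode (suc q₀) (suc N₀ + l) S M 3) S-size
    (unionConcat-IsCode D-code B-code (λ {i} {j} Du Du′ → trans (proj₁ D-part i _ Du) (sym (proj₁ D-part j _ Du′)))
                        (proj₂ (proj₂ D-part)) (proj₂ (proj₂ B-part)))

  lengthen : PerfectLengthenings → PerfectLengthening
  lengthen (C , (j , a , C-short) , C-perfect-code , C-part) =
    unionJoin D C , perfect , IsPerfect1⇒IsCode perfect (perfect-size hn (≤-trans sk≤N (m≤n⇒m≤1+n (m≤m+n (suc N₀) l))))
    , joinPos (suc N₀) j , a , unionJoin-IsShortening C-short
    where perfect = Lengthening.unionJoin-perfect D-part D-dist C-part (proj₁ ∘ C-perfect-code)

  shorten : PerfectLengthening → PerfectLengthenings
  shorten (C , C-perfect , _ , j , a , C-short) =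
    slice , (Fin.zero , a , slice-IsShortening)
    , (λ i → slice-perfect i , IsPerfect1⇒IsCode (slice-perfect i) (perfect-size hn′ (m≤n⇒m≤1+n k≤l))) , slice-partition
    where
    p = joinPos (suc N₀) Fin.zero
    open Shortening D-part D-dist B-part (IsPerfect1-preimage (moveTo-↔ p j) (moveTo-isometric p j) C-perfect)
                    (IsShortening-moveTo {C = C} p C-short) u* u*∉M₀

  partition-of-space : Σ (Fin (suc q₀ ^ suc k) → Code (suc q₀) (suc N₀ + l)) λ P →
    IsPartitionOf Whole P × (∀ i → IsCode (suc q₀) (suc N₀ + l) (P i) (suc q₀ ^ (suc N₀ + l ∸ suc k)) 3)
    × ∃[ i ] (∀ x → (P i x → S x) × (S x → P i x))
  partition-of-space =
    partition index , partition-IsPartition index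
    , (λ x → subst (λ M → IsCode (suc q₀) (suc N₀ + l) (partition index x) M 3) S-size (part-IsCode D-code B-code _ _))
    , Inverse.from index (Fin.zero , Fin.zero) , partition-zero index
    where
    open Partition D-part B-part
    index : Fin (suc q₀ ^ suc k) ↔ (Fin (suc q₀) × Fin (suc N₀))
    index = Finₚ.*↔× ↔-∘ cast-↔ (cong (suc q₀ *_) (sym N≡q^k))

theorem3 :
    ∀ (q m n n′ n″ : ℕ) .{{_ : NonZero q}} →
    2 ≤ q → 2 ≤ m →
    (q ∸ 1) * n ≡ q ^ m ∸ 1 →
    (q ∸ 1) * n′ ≡ q ^ (m ∸ 1) ∸ 1 →
    n″ ≡ q ^ (m ∸ 1) →
    (B : Fin n″ → Code q (n′ ∸ 1)) →
    IsPartitionOf Whole B →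
    (∀ i → IsCode q (n′ ∸ 1) (B i) (q ^ (n′ ∸ 1 ∸ (m ∸ 1))) 3) →
    (D : Fin n″ → Code q n″) →
    IsPartitionOf (Mcode q n″ 0) D →
    (∀ i → IsCode q n″ (D i) (q ^ (n″ ∸ m)) 3) →
    -- (i)
    IsCode q (n″ + (n′ ∸ 1)) (unionConcat D B) (q ^ (n ∸ 1 ∸ m)) 3
    -- (ii)
    × ((Σ (Code q (suc (n″ + (n′ ∸ 1)))) λ C →
          IsPerfect1 C × IsCode q (suc (n″ + (n′ ∸ 1))) C (q ^ (n ∸ m)) 3
          × ∃[ j ] ∃[ a ] IsShortening C j a (unionConcat D B))
       ⇔
       (Σ (Fin n″ → Code q (suc (n′ ∸ 1))) λ C →
          (∃[ j ] ∃[ a ] (∀ i → IsShortening (C i) j a (B i)))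
          × (∀ i → IsPerfect1 (C i)
                   × IsCode q (suc (n′ ∸ 1)) (C i) (q ^ (n′ ∸ (m ∸ 1))) 3)
          × IsPartitionOf Whole C))
    -- (iii)
    × (Σ (Fin (q ^ m) → Code q (n″ + (n′ ∸ 1))) λ P →
          IsPartitionOf Whole P
          × (∀ i → IsCode q (n″ + (n′ ∸ 1)) (P i) (q ^ (n ∸ 1 ∸ m)) 3)
          × ∃[ i ] (∀ x → (P i x → unionConcat D B x) × (unionConcat D B x → P i x)))
-- For m = 2 we get n′ = 1, and B would split the one-point space H(0,q) into q ≥ 2 codes of size 1.
theorem3 _ _ _ _ _ (s≤s (s≤s {n = r} z≤n)) (s≤s (s≤s {n = zero} z≤n)) _ hn′ refl B B-part B-code _ _ _
  with refl ← *-cancelˡ-≡ _ 1 (suc r) hn′ =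
  ⊥-elim (no-partition-of-a-point B (proj₂ (proj₂ B-part)) (proj₁ ∘ B-code))
theorem3 _ _ n n′ n″ (s≤s (s≤s {n = r} z≤n)) (s≤s (s≤s {n = suc m″} z≤n)) hn hn′ hn″ B B-part B-code D D-part D-code
  with s≤s {n = N₀} z≤n ← subst (1 ≤_) (sym hn″) (m^n>0 (suc (suc r)) (suc (suc m″)))
  with s≤s {n = l} k≤l ← n′-large {r} {n′} m″ hn′
  with refl ← trans (length-split {suc r} {n} (suc (suc m″)) hn hn′) (trans (cong (_+ suc l) (sym hn″)) (+-suc (suc N₀) l))
  = S-IsCode , mk⇔ shorten lengthen , partition-of-space
  where open Construction hn″ k≤l hn′ hn B-part B-code D-part D-code e₁ (e₁∉M₀ {r} {N₀})
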